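{- Let $p$ be a prime, $f$ a positive integer and $q=p^f$. Let $h,k$ be nonnegative integers with $h\ge k$ and $f\mid h+k$, and let $r,s$ be positive integers. Then \[ (-1)^{ps}\sum_{b\in\mathbb{Z}} \binom{s\,p^k}{ b(q-1)-r}\equiv (-1)^{pr}\sum_{b\in\mathbb{Z}} \binom{r\,p^h}{ b(q-1)-s} \pmod{p^{k+1}}. \]
   Context: For a nonnegative integer $n$ and an integer $m$, $\binom{n}{m}$ denotes the usual binomial coefficient, with $\binom{n}{m}=0$ when $m<0$ or $m>n$; thus the sums over $b\in\mathbb{Z}$ are finite. -}

module Defs where

open import Data.Nat using (ℕ; zero; suc; _+_; _*_)
open import Data.Nat.Combinatorics using (_C_)
open import Data.Integer using (ℤ; +_; -[1+_]; 0ℤ) renaming (_+_ to _+ℤ_; _*_ to _*ℤ_; _-_ to _-ℤ_)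
open import Data.List using (List; map; foldr; upTo)

binomZ : ℕ → ℤ → ℤ
binomZ n (+ m)     = + (n C m)
binomZ n -[1+ _ ]  = 0ℤ

sumWindow : ℕ → (ℤ → ℤ) → ℤ
sumWindow N g = foldr _+ℤ_ 0ℤ (map (λ i → g ((+ i) -ℤ (+ N))) (upTo (suc (N + N))))

-- For d ≥ 1 and r ≥ 1 every nonzero term has |b| ≤ n + r, so summing over the
-- window b ∈ [-(n+r), n+r] gives exactly the (finite) sum over all of ℤ.
binomSum : ℕ → ℕ → ℕ → ℤ
binomSum n d r = sumWindow (n + r) (λ b → binomZ n ((b *ℤ (+ d)) -ℤ (+ r)))

-- Let d = q − 1 and let C be the matrix of the map 0 ↦ 1 ↦ 2 ↦ ⋯ ↦ d ↦ 1 on {0, …, d}. Its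
-- eigenvalues are 0 and the d-th roots of unity, i.e. the Teichmüller representatives of F_q, and
-- tr C^m = d·[d ∣ m] for m ≥ 1, so by the binomial theorem, for r ≥ 1,
--   d · Σ_b binom(n, b d − r) = tr (C^r (C + 1)^n).
-- The permutation x ↦ −1 − x of F_q is lifted to matrices: Z = −(C + 1) satisfies Z^q ≡ Z (mod p),
-- so Y = Z^(q^N) satisfies Y ≡ Z (mod p) and Y^q ≡ Y (mod p^(N+1)), and the matrix U with columns
-- Y^b e₀ conjugates C into Y modulo p^(N+1). Since A ≡ B (mod p) implies A^(p^k) ≡ B^(p^k)
-- (mod p^(k+1)) for commuting A and B, and C^(a p^k) = C^r for a = r p^h because f ∣ h + k,
--   d · Σ_b binom(s p^k, b d − r) = tr (C^a (C + 1)^s)^(p^k) ≡ tr (Z^a (Z + 1)^s)^(p^k)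
--                                = (−1)^((a+s) p^k) tr ((C + 1)^(a p^k) C^(s p^k))   (mod p^(k+1)).
-- Lifting (C + 1)^(p^k) ≡ C^(p^k) + 1 (mod p) to the p^h-th power turns the last trace, modulo
-- p^(h+1), into tr (C^(s p^k) (C^(p^k) + 1)^a) = d · Σ_b binom(r p^h, b d − s), as p ∤ d.
-- Cancelling d and comparing the signs modulo p^(k+1) gives the theorem.

module Submission where

open import Algebra.Bundles using (CommutativeRing; Ring)
open import Algebra.Structures using (IsRing)
import Algebra.Construct.Pointwise as Pointwise
open import Data.Fin using (Fin; zero; suc)
open import Data.Nat as ℕ using (ℕ; zero; suc)
import Data.Nat.Properties as ℕP
open import Data.Product using (_,_)
open import Function using (_∘_; id)
open import Level using (_⊔_)
open import Relation.Binary.Core using (Rel)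
open import Relation.Binary.PropositionalEquality as ≡ using (_≡_; _≢_)
open import Relation.Nullary using (contradiction)

module Matrices {c ℓ} (R : CommutativeRing c ℓ) where

  open CommutativeRing R hiding (zero)
  open import Algebra.Properties.Semiring.Sum semiring public
  open import Relation.Binary.Reasoning.Setoid setoid

  Matrix : ℕ → Set c
  Matrix n = Fin n → Fin n → Carrier

  δ : ∀ {n} → Fin n → Fin n → Carrier
  δ zero    zero    = 1#
  δ zero    (suc _) = 0#
  δ (suc _) zero    = 0#
  δ (suc i) (suc j) = δ i j

  δ-refl : ∀ {n} (i : Fin n) → δ i i ≡ 1#
  δ-refl zero    = ≡.refl
  δ-refl (suc i) = δ-refl i

  δ-≢ : ∀ {n} {i j : Fin n} → i ≢ j → δ i j ≡ 0#
  δ-≢ {i = zero}  {zero}  i≢j = contradiction ≡.refl i≢j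
  δ-≢ {i = zero}  {suc j} _   = ≡.refl
  δ-≢ {i = suc i} {zero}  _   = ≡.refl
  δ-≢ {i = suc i} {suc j} i≢j = δ-≢ (i≢j ∘ ≡.cong suc)

  private
    ∑-0*f : ∀ {n} (f : Fin n → Carrier) → ∑[ k < n ] (0# * f k) ≈ 0#
    ∑-0*f {n} f = trans (sum-cong-≋ (λ k → zeroˡ (f k))) (sum-replicate-zero n)

    ∑-f*0 : ∀ {n} (f : Fin n → Carrier) → ∑[ k < n ] (f k * 0#) ≈ 0#
    ∑-f*0 {n} f = trans (sum-cong-≋ (λ k → zeroʳ (f k))) (sum-replicate-zero n)

  ∑-δ*f : ∀ {n} (i : Fin n) (f : Fin n → Carrier) → ∑[ k < n ] (δ i k * f k) ≈ f i
  ∑-δ*f zero    f = trans (+-cong (*-identityˡ (f zero)) (∑-0*f (f ∘ suc))) (+-identityʳ (f zero))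
  ∑-δ*f (suc i) f = trans (+-cong (zeroˡ (f zero)) (∑-δ*f i (f ∘ suc))) (+-identityˡ (f (suc i)))

  ∑-f*δ : ∀ {n} (i : Fin n) (f : Fin n → Carrier) → ∑[ k < n ] (f k * δ k i) ≈ f i
  ∑-f*δ zero    f = trans (+-cong (*-identityʳ (f zero)) (∑-f*0 (f ∘ suc))) (+-identityʳ (f zero))
  ∑-f*δ (suc i) f = trans (+-cong (zeroʳ (f zero)) (∑-f*δ i (f ∘ suc))) (+-identityˡ (f (suc i)))

  module _ {n : ℕ} where

    infix  4 _≋_
    infixl 6 _+ᴹ_
    infixl 7 _*ᴹ_ _∙_
    infix  8 -ᴹ_

    _≋_ : Rel (Matrix n) ℓ
    A ≋ B = ∀ i j → A i j ≈ B i j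

    -- Opaque, so that unification compares matrix expressions instead of their entries.
    opaque
      _+ᴹ_ : Matrix n → Matrix n → Matrix n
      (A +ᴹ B) i j = A i j + B i j

      _*ᴹ_ : Matrix n → Matrix n → Matrix n
      (A *ᴹ B) i j = ∑[ k < n ] (A i k * B k j)

      -ᴹ_ : Matrix n → Matrix n
      (-ᴹ A) i j = - A i j

      0ᴹ 1ᴹ : Matrix n
      0ᴹ _ _ = 0#
      1ᴹ = δ

      _∙_ : Carrier → Matrix n → Matrix n
      (a ∙ A) i j = a * A i j

    trace : Matrix n → Carrier
    trace A = ∑[ i < n ] A i i

    ⟦_⟧ : (Fin n → Fin n) → Matrix n
    ⟦ g ⟧ i j = δ i (g j)

    opaque
      unfolding _+ᴹ_ _*ᴹ_ -ᴹ_ 0ᴹ 1ᴹ _∙_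

      *ᴹ-cong : ∀ {A A′ B B′} → A ≋ A′ → B ≋ B′ → A *ᴹ B ≋ A′ *ᴹ B′
      *ᴹ-cong A≋A′ B≋B′ i j = sum-cong-≋ (λ k → *-cong (A≋A′ i k) (B≋B′ k j))

      *ᴹ-assoc : ∀ A B C → (A *ᴹ B) *ᴹ C ≋ A *ᴹ (B *ᴹ C)
      *ᴹ-assoc A B C i j = begin
        ∑[ l < n ] (∑[ k < n ] (A i k * B k l) * C l j)
          ≈⟨ sum-cong-≋ (λ l → *-distribʳ-sum {n} (C l j) (λ k → A i k * B k l)) ⟩
        ∑[ l < n ] ∑[ k < n ] (A i k * B k l * C l j)
          ≈⟨ ∑-comm (λ l k → A i k * B k l * C l j) ⟩
        ∑[ k < n ] ∑[ l < n ] (A i k * B k l * C l j)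
          ≈⟨ sum-cong-≋ (λ k → sum-cong-≋ (λ l → *-assoc (A i k) (B k l) (C l j))) ⟩
        ∑[ k < n ] ∑[ l < n ] (A i k * (B k l * C l j))
          ≈⟨ sum-cong-≋ (λ k → *-distribˡ-sum {n} (A i k) (λ l → B k l * C l j)) ⟨
        ∑[ k < n ] (A i k * ∑[ l < n ] (B k l * C l j))
          ∎

      *ᴹ-identityˡ : ∀ A → 1ᴹ *ᴹ A ≋ A
      *ᴹ-identityˡ A i j = ∑-δ*f i (λ k → A k j)

      *ᴹ-identityʳ : ∀ A → A *ᴹ 1ᴹ ≋ A
      *ᴹ-identityʳ A i j = ∑-f*δ j (A i)

      *ᴹ-distribˡ-+ᴹ : ∀ A B C → A *ᴹ (B +ᴹ C) ≋ A *ᴹ B +ᴹ A *ᴹ C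
      *ᴹ-distribˡ-+ᴹ A B C i j =
        trans (sum-cong-≋ (λ k → distribˡ (A i k) (B k j) (C k j)))
              (∑-distrib-+ (λ k → A i k * B k j) (λ k → A i k * C k j))

      *ᴹ-distribʳ-+ᴹ : ∀ A B C → (B +ᴹ C) *ᴹ A ≋ B *ᴹ A +ᴹ C *ᴹ A
      *ᴹ-distribʳ-+ᴹ A B C i j =
        trans (sum-cong-≋ (λ k → distribʳ (A k j) (B i k) (C i k)))
              (∑-distrib-+ (λ k → B i k * A k j) (λ k → C i k * A k j))

      trace-cong : ∀ {A B} → A ≋ B → trace A ≈ trace B
      trace-cong A≋B = sum-cong-≋ (λ i → A≋B i i)

      trace-*ᴹ-comm : ∀ A B → trace (A *ᴹ B) ≈ trace (B *ᴹ A)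
      trace-*ᴹ-comm A B =
        trans (∑-comm (λ i k → A i k * B k i)) (sum-cong-≋ (λ k → sum-cong-≋ (λ i → *-comm (A i k) (B k i))))

      *ᴹ-⟦⟧ : ∀ A g → A *ᴹ ⟦ g ⟧ ≋ λ i j → A i (g j)
      *ᴹ-⟦⟧ A g i j = ∑-f*δ (g j) (A i)

      1ᴹ≋⟦id⟧ : 1ᴹ ≋ ⟦ id ⟧
      1ᴹ≋⟦id⟧ i j = refl

      trace-+ᴹ : ∀ A B → trace (A +ᴹ B) ≈ trace A + trace B
      trace-+ᴹ A B = ∑-distrib-+ (λ i → A i i) (λ i → B i i)

      trace-0ᴹ : trace 0ᴹ ≈ 0#
      trace-0ᴹ = sum-replicate-zero n

      -ᴹ≋-1∙ : ∀ A → -ᴹ A ≋ (- 1#) ∙ A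
      -ᴹ≋-1∙ A i j = sym (-1*x≈-x (A i j))
        where open import Algebra.Properties.Ring ring using (-1*x≈-x)

      ∙-congˡ : ∀ a {A B} → A ≋ B → a ∙ A ≋ a ∙ B
      ∙-congˡ a A≋B i j = *-congˡ (A≋B i j)

      ∙-identityˡ : ∀ A → 1# ∙ A ≋ A
      ∙-identityˡ A i j = *-identityˡ (A i j)

      trace-∙ : ∀ a A → trace (a ∙ A) ≈ a * trace A
      trace-∙ a A = sym (*-distribˡ-sum {n} a (λ i → A i i))

      ∙-*ᴹ-∙ : ∀ a b A B → (a ∙ A) *ᴹ (b ∙ B) ≋ (a * b) ∙ (A *ᴹ B)
      ∙-*ᴹ-∙ a b A B i j = begin
        ∑[ k < n ] (a * A i k * (b * B k j))   ≈⟨ sum-cong-≋ (λ k → interchange (A i k) (B k j)) ⟩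
        ∑[ k < n ] (a * b * (A i k * B k j))   ≈⟨ *-distribˡ-sum {n} (a * b) (λ k → A i k * B k j) ⟨
        a * b * ∑[ k < n ] (A i k * B k j)     ∎
        where
        interchange : ∀ x y → a * x * (b * y) ≈ a * b * (x * y)
        interchange x y = begin
          a * x * (b * y)   ≈⟨ *-assoc a x (b * y) ⟩
          a * (x * (b * y)) ≈⟨ *-congˡ (x∙yz≈y∙xz x b y) ⟩
          a * (b * (x * y)) ≈⟨ *-assoc a b (x * y) ⟨
          a * b * (x * y)   ∎
          where open import Algebra.Properties.CommutativeSemigroup *-commutativeSemigroup

      isMatrixRing : IsRing _≋_ _+ᴹ_ _*ᴹ_ -ᴹ_ 0ᴹ 1ᴹ
      isMatrixRing = record
        { +-isAbelianGroup = P.isAbelianGroup (P.isAbelianGroup +-isAbelianGroup)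
        ; *-cong = *ᴹ-cong
        ; *-assoc = *ᴹ-assoc
        ; *-identity = *ᴹ-identityˡ , *ᴹ-identityʳ
        ; distrib = *ᴹ-distribˡ-+ᴹ , *ᴹ-distribʳ-+ᴹ
        }
        where module P = Pointwise (Fin n)

  matrixRing : ℕ → Ring c ℓ
  matrixRing n = record { isRing = isMatrixRing {n} }

module CommutingElements {c ℓ} (R : Ring c ℓ) where

  open Ring R
  open import Algebra.Properties.Ring R using (-‿distribˡ-*; -‿distribʳ-*; [y-z]x≈yx-zx)
  open import Algebra.Properties.Semiring.Exp semiring using (_^_; ^-congʳ; ^-assocʳ)
  open import Algebra.Properties.Semiring.Mult semiring using (_×_; ×-comm-*)
  open import Relation.Binary.Reasoning.Setoid setoid

  Commute : Carrier → Carrier → Set ℓ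
  Commute x y = x * y ≈ y * x

  x^[m*n]≈[x^n]^m : ∀ x m n → x ^ (m ℕ.* n) ≈ (x ^ n) ^ m
  x^[m*n]≈[x^n]^m x m n = trans (^-congʳ x (ℕP.*-comm m n)) (sym (^-assocʳ x n m))

  1#^n≈1# : ∀ n → 1# ^ n ≈ 1#
  1#^n≈1# zero    = refl
  1#^n≈1# (suc n) = trans (*-identityˡ (1# ^ n)) (1#^n≈1# n)

  commute-*ʳ : ∀ {w x y} → Commute w x → Commute w y → Commute w (x * y)
  commute-*ʳ {w} {x} {y} wx wy = begin
    w * (x * y) ≈⟨ *-assoc w x y ⟨
    w * x * y   ≈⟨ *-congʳ wx ⟩
    x * w * y   ≈⟨ *-assoc x w y ⟩
    x * (w * y) ≈⟨ *-congˡ wy ⟩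
    x * (y * w) ≈⟨ *-assoc x y w ⟨
    x * y * w   ∎

  commute-+ʳ : ∀ {w x y} → Commute w x → Commute w y → Commute w (x + y)
  commute-+ʳ {w} {x} {y} wx wy = trans (distribˡ w x y) (trans (+-cong wx wy) (sym (distribʳ w x y)))

  commute-1#ʳ : ∀ w → Commute w 1#
  commute-1#ʳ w = trans (*-identityʳ w) (sym (*-identityˡ w))

  commute--ʳ : ∀ {w x} → Commute w x → Commute w (- x)
  commute--ʳ {w} {x} wx = trans (sym (-‿distribʳ-* w x)) (trans (-‿cong wx) (-‿distribˡ-* x w))

  commute-^ʳ : ∀ {w x} → Commute w x → ∀ n → Commute w (x ^ n)
  commute-^ʳ {w} wx zero    = commute-1#ʳ w
  commute-^ʳ     wx (suc n) = commute-*ʳ wx (commute-^ʳ wx n)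

  commute-^ : ∀ {x y} → Commute x y → ∀ m n → Commute (x ^ m) (y ^ n)
  commute-^ xy m n = sym (commute-^ʳ (sym (commute-^ʳ xy n)) m)

  *-^-distrib : ∀ {x y} → Commute x y → ∀ n → (x * y) ^ n ≈ x ^ n * y ^ n
  *-^-distrib {x} {y} xy zero    = sym (*-identityˡ 1#)
  *-^-distrib {x} {y} xy (suc n) = begin
    x * y * (x * y) ^ n       ≈⟨ *-congˡ (*-^-distrib xy n) ⟩
    x * y * (x ^ n * y ^ n)   ≈⟨ *-assoc x y _ ⟩
    x * (y * (x ^ n * y ^ n)) ≈⟨ *-congˡ (*-assoc y (x ^ n) (y ^ n)) ⟨
    x * (y * x ^ n * y ^ n)   ≈⟨ *-congˡ (*-congʳ (commute-^ʳ (sym xy) n)) ⟩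
    x * (x ^ n * y * y ^ n)   ≈⟨ *-congˡ (*-assoc (x ^ n) y (y ^ n)) ⟩
    x * (x ^ n * (y * y ^ n)) ≈⟨ *-assoc x (x ^ n) _ ⟨
    x * x ^ n * (y * y ^ n)   ∎

  geometric : Carrier → Carrier → ℕ → Carrier
  geometric x y zero    = 0#
  geometric x y (suc n) = x * geometric x y n + y ^ n

  x^n≈y^n+[x-y]*geometric : ∀ {x y} → Commute x y → ∀ n → x ^ n ≈ y ^ n + (x - y) * geometric x y n
  x^n≈y^n+[x-y]*geometric {x} {y} xy zero    = sym (trans (+-congˡ (zeroʳ (x - y))) (+-identityʳ 1#))
  x^n≈y^n+[x-y]*geometric {x} {y} xy (suc n) = begin
    x * x ^ n                                      ≈⟨ *-congˡ (x^n≈y^n+[x-y]*geometric xy n) ⟩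
    x * (y ^ n + (x - y) * G)                      ≈⟨ distribˡ x (y ^ n) _ ⟩
    x * y ^ n + x * ((x - y) * G)                  ≈⟨ +-cong split (*-assoc x (x - y) G) ⟨
    (y * y ^ n + (x - y) * y ^ n) + x * (x - y) * G ≈⟨ +-congˡ (*-congʳ x[x-y]≈[x-y]x) ⟩
    (y * y ^ n + (x - y) * y ^ n) + (x - y) * x * G ≈⟨ +-assoc _ _ _ ⟩
    y * y ^ n + ((x - y) * y ^ n + (x - y) * x * G) ≈⟨ +-congˡ (+-comm _ _) ⟩
    y * y ^ n + ((x - y) * x * G + (x - y) * y ^ n) ≈⟨ +-congˡ (+-congʳ (*-assoc (x - y) x G)) ⟩
    y * y ^ n + ((x - y) * (x * G) + (x - y) * y ^ n) ≈⟨ +-congˡ (distribˡ (x - y) (x * G) (y ^ n)) ⟨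
    y * y ^ n + (x - y) * (x * G + y ^ n)          ∎
    where
    G = geometric x y n
    x[x-y]≈[x-y]x : x * (x - y) ≈ (x - y) * x
    x[x-y]≈[x-y]x = commute-+ʳ (refl {x * x}) (commute--ʳ xy)
    split : y * y ^ n + (x - y) * y ^ n ≈ x * y ^ n
    split = begin
      y * y ^ n + (x - y) * y ^ n         ≈⟨ +-congˡ ([y-z]x≈yx-zx (y ^ n) x y) ⟩
      y * y ^ n + (x * y ^ n - y * y ^ n) ≈⟨ +-comm _ _ ⟩
      (x * y ^ n - y * y ^ n) + y * y ^ n ≈⟨ +-assoc _ _ _ ⟩
      x * y ^ n + (- (y * y ^ n) + y * y ^ n) ≈⟨ +-congˡ (-‿inverseˡ _) ⟩
      x * y ^ n + 0#                      ≈⟨ +-identityʳ _ ⟩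
      x * y ^ n                           ∎

  geometric-diagonal : ∀ y n → geometric y y (suc n) ≈ suc n × y ^ n
  geometric-diagonal y zero    = trans (+-congʳ (zeroʳ y)) (trans (+-identityˡ 1#) (sym (+-identityʳ 1#)))
  geometric-diagonal y (suc n) = begin
    y * geometric y y (suc n) + y ^ suc n ≈⟨ +-congʳ (*-congˡ (geometric-diagonal y n)) ⟩
    y * (suc n × y ^ n) + y ^ suc n       ≈⟨ +-congʳ (×-comm-* (suc n) y (y ^ n)) ⟩
    suc n × y ^ suc n + y ^ suc n         ≈⟨ +-comm _ _ ⟩
    suc (suc n) × y ^ suc n               ∎

  Bicommutant : Carrier → Carrier → Set (c ⊔ ℓ)
  Bicommutant a x = ∀ w → Commute w a → Commute w x

  bicommutant-self : ∀ a → Bicommutant a a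
  bicommutant-self a w wa = wa

  bicommutant-1# : ∀ a → Bicommutant a 1#
  bicommutant-1# a w _ = commute-1#ʳ w

  bicommutant-+ : ∀ {a x y} → Bicommutant a x → Bicommutant a y → Bicommutant a (x + y)
  bicommutant-+ x∈ y∈ w wa = commute-+ʳ (x∈ w wa) (y∈ w wa)

  bicommutant-* : ∀ {a x y} → Bicommutant a x → Bicommutant a y → Bicommutant a (x * y)
  bicommutant-* x∈ y∈ w wa = commute-*ʳ (x∈ w wa) (y∈ w wa)

  bicommutant-- : ∀ {a x} → Bicommutant a x → Bicommutant a (- x)
  bicommutant-- x∈ w wa = commute--ʳ (x∈ w wa)

  bicommutant-^ : ∀ {a x} → Bicommutant a x → ∀ n → Bicommutant a (x ^ n)
  bicommutant-^ x∈ n w wa = commute-^ʳ (x∈ w wa) n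

  bicommutant-commute : ∀ {a x y} → Bicommutant a x → Bicommutant a y → Commute x y
  bicommutant-commute {a} x∈ y∈ = y∈ _ (sym (x∈ a refl))

open import Defs

-- Its own scope: the ℤ operators opened here would clash with the ℕ ones in the statement of theorem1p2.
module _ where

  import Algebra.Properties.CommutativeSemigroup
  import Algebra.Properties.Semiring.Binomial
  open import Data.Fin using (toℕ; fromℕ; inject₁)
  import Data.Fin.Properties as FinP
  open import Data.Integer as ℤ using (ℤ; +_; -[1+_]; 0ℤ; 1ℤ; -1ℤ; _+_; _*_; -_; _-_)
  import Data.Integer.Properties as ℤP
  open import Data.Integer.Divisibility.Signed as ℤ∣ using (_∣_; divides)
  open import Data.Integer.Tactic.RingSolver using (solve-∀)
  open import Data.List using (map; foldr; applyUpTo)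
  open import Data.Nat using (NonZero; pred; _^_; _<_; _≤_)
  open import Data.Nat.Combinatorics using (nCk+nC[k+1]≡[n+1]C[k+1]; nCn≡1; nC1≡n; k>n⇒nCk≡0)
    renaming (_C_ to _choose_)
  open import Data.Nat.Coprimality as Coprimality using (Coprime; coprime-divisor)
  open import Data.Nat.DivMod as DM using (_%_; _/_)
  import Data.Nat.Divisibility as ℕ∣
  open import Data.Nat.GCD using (gcd[m,n]∣m; gcd[m,n]∣n)
  open import Data.Nat.Primality using (Prime; euclidsLemma; prime⇒irreducible; prime⇒nonZero; prime⇒nonTrivial; ¬prime[0])
  open import Data.Product using (∃)
  open import Data.Sum using (_⊎_; inj₁; inj₂)
  open import Relation.Binary.Bundles using (Setoid)
  open import Relation.Binary.Structures using (IsEquivalence)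
  open import Relation.Nullary using (yes; no; ¬_)

  module ℕ* = Algebra.Properties.CommutativeSemigroup ℕP.*-commutativeSemigroup
  module ℤ* = Algebra.Properties.CommutativeSemigroup ℤP.*-commutativeSemigroup

  -- A record rather than m ∣ a - b, so that a, b and m can be inferred from a proof.
  infix 4 _≡_mod_
  record _≡_mod_ (a b m : ℤ) : Set where
    constructor congruent
    field divides-difference : m ∣ a - b
  open _≡_mod_ public

  module _ {m : ℤ} where

    ≡⇒≡-mod : ∀ {a b} → a ≡ b → a ≡ b mod m
    ≡⇒≡-mod {a} ≡.refl = congruent (≡.subst (m ∣_) (≡.sym (ℤP.+-inverseʳ a)) (ℤ∣.∣n⇒∣m*n 0ℤ ℤ∣.∣-refl))

    ≡-mod-isEquivalence : IsEquivalence (λ a b → a ≡ b mod m)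
    ≡-mod-isEquivalence = record
      { refl  = ≡⇒≡-mod ≡.refl
      ; sym   = λ {a} {b} (congruent m∣a-b) → congruent (≡.subst (m ∣_) (negate a b) (ℤ∣.∣m⇒∣-m m∣a-b))
      ; trans = λ {a} {b} {c} (congruent m∣a-b) (congruent m∣b-c) →
          congruent (≡.subst (m ∣_) (telescope a b c) (ℤ∣.∣m∣n⇒∣m+n m∣a-b m∣b-c))
      }
      where
      negate : ∀ a b → - (a - b) ≡ b - a
      negate = solve-∀
      telescope : ∀ a b c → (a - b) + (b - c) ≡ a - c
      telescope = solve-∀

    +-cong-mod : ∀ {a b c e} → a ≡ b mod m → c ≡ e mod m → a + c ≡ b + e mod m
    +-cong-mod {a} {b} {c} {e} (congruent m∣a-b) (congruent m∣c-e) =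
      congruent (≡.subst (m ∣_) (regroup a b c e) (ℤ∣.∣m∣n⇒∣m+n m∣a-b m∣c-e))
      where
      regroup : ∀ a b c e → (a - b) + (c - e) ≡ (a + c) - (b + e)
      regroup = solve-∀

    *-cong-mod : ∀ {a b c e} → a ≡ b mod m → c ≡ e mod m → a * c ≡ b * e mod m
    *-cong-mod {a} {b} {c} {e} (congruent m∣a-b) (congruent m∣c-e) =
      congruent (≡.subst (m ∣_) (regroup a b c e)
                         (ℤ∣.∣m∣n⇒∣m+n (ℤ∣.∣m⇒∣m*n c m∣a-b) (ℤ∣.∣n⇒∣m*n b m∣c-e)))
      where
      regroup : ∀ a b c e → (a - b) * c + b * (c - e) ≡ a * c - b * e
      regroup = solve-∀

    *-congˡ-mod : ∀ a {b c} → b ≡ c mod m → a * b ≡ a * c mod m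
    *-congˡ-mod a = *-cong-mod (≡⇒≡-mod {a} ≡.refl)

    *-congʳ-mod : ∀ a {b c} → b ≡ c mod m → b * a ≡ c * a mod m
    *-congʳ-mod a b≡c = *-cong-mod b≡c (≡⇒≡-mod {a} ≡.refl)

    -‿cong-mod : ∀ {a b} → a ≡ b mod m → - a ≡ - b mod m
    -‿cong-mod {a} {b} (congruent m∣a-b) = congruent (≡.subst (m ∣_) (regroup a b) (ℤ∣.∣m⇒∣-m m∣a-b))
      where
      regroup : ∀ a b → - (a - b) ≡ - a - - b
      regroup = solve-∀

    ∣⇒≡0-mod : ∀ {a} → m ∣ a → a ≡ 0ℤ mod m
    ∣⇒≡0-mod {a} m∣a = congruent (≡.subst (m ∣_) (≡.sym (ℤP.+-identityʳ a)) m∣a)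

  ≡-mod-setoid : ℤ → Setoid _ _
  ≡-mod-setoid m = record { isEquivalence = ≡-mod-isEquivalence {m} }

  module ≡ₘ {m : ℤ} = Setoid (≡-mod-setoid m)

  ≡-mod-weaken : ∀ {m m′ a b} → m ∣ m′ → a ≡ b mod m′ → a ≡ b mod m
  ≡-mod-weaken m∣m′ (congruent m′∣a-b) = congruent (ℤ∣.∣-trans m∣m′ m′∣a-b)

  ≡0-mod-* : ∀ {m m′ a b} → a ≡ 0ℤ mod m → b ≡ 0ℤ mod m′ → a * b ≡ 0ℤ mod m * m′
  ≡0-mod-* {m} {m′} {a} {b} (congruent (divides x a-0≡xm)) (congruent (divides y b-0≡ym)) =
    ∣⇒≡0-mod (divides (x * y) (begin
      a * b                 ≡⟨ ≡.cong₂ _*_ (≡.trans (≡.sym (ℤP.+-identityʳ a)) a-0≡xm)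
                                          (≡.trans (≡.sym (ℤP.+-identityʳ b)) b-0≡ym) ⟩
      (x * m) * (y * m′)    ≡⟨ interchange x m y m′ ⟩
      (x * y) * (m * m′)    ∎))
    where
    open ≡.≡-Reasoning
    interchange : ∀ x m y m′ → (x * m) * (y * m′) ≡ (x * y) * (m * m′)
    interchange = solve-∀

  coprime-^ : ∀ {m n} → Coprime m n → ∀ j → Coprime (m ^ j) n
  coprime-^ m⊥n zero    (i∣1 , _)          = ℕ∣.∣1⇒≡1 i∣1
  coprime-^ {m} {n} m⊥n (suc j) {i} (i∣m*m^j , i∣n) = coprime-^ m⊥n j (i∣m^j , i∣n)
    where
    i⊥m : Coprime i m
    i⊥m = Coprimality.gcd≡1⇒coprime (m⊥n (gcd[m,n]∣n i m , ℕ∣.∣-trans (gcd[m,n]∣m i m) i∣n))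
    i∣m^j : i ℕ∣.∣ m ^ j
    i∣m^j = coprime-divisor i⊥m i∣m*m^j

  *-cancelˡ-coprime-mod : ∀ {m d a b} → Coprime m d → + d * a ≡ + d * b mod + m → a ≡ b mod + m
  *-cancelˡ-coprime-mod {m} {d} {a} {b} m⊥d (congruent m∣da-db) = congruent (ℤ∣.∣ᵤ⇒∣ (coprime-divisor m⊥d
    (≡.subst (m ℕ∣.∣_) (ℤP.abs-* (+ d) (a - b)) (ℤ∣.∣⇒∣ᵤ (≡.subst (+ m ∣_) (factor (+ d) a b) m∣da-db)))))
    where
    factor : ∀ d a b → d * a - d * b ≡ d * (a - b)
    factor = solve-∀

  ^-monoʳ-∣ : ∀ m {i j} → i ℕ.≤ j → m ^ i ℕ∣.∣ m ^ j
  ^-monoʳ-∣ m {i} i≤j with ℕP.m≤n⇒∃[o]m+o≡n i≤j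
  ... | o , ≡.refl = ℕ∣.divides (m ^ o) (≡.trans (ℕP.^-distribˡ-+-* m i o) (ℕP.*-comm (m ^ i) (m ^ o)))

  pred[p^[1+f]]≢0 : ∀ {p} → Prime p → ∀ f → NonZero (pred (p ^ suc f))
  pred[p^[1+f]]≢0 {p} pr f =
    ℕ.>-nonZero (ℕP.m<n⇒0<n∸m (ℕP.<-≤-trans (ℕ.nonTrivial⇒n>1 p {{prime⇒nonTrivial pr}}) (ℕP.m≤m*n p (p ^ f))))
    where instance _ = ℕP.m^n≢0 p f {{prime⇒nonZero pr}}

  -1^[2*n]≡1 : ∀ n → -1ℤ ℤ.^ (2 ℕ.* n) ≡ 1ℤ
  -1^[2*n]≡1 n = ≡.trans (≡.sym (ℤP.^-*-assoc -1ℤ 2 n)) (ℤP.^-zeroˡ n)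

  -1^[n+n]≡1 : ∀ n → -1ℤ ℤ.^ (n ℕ.+ n) ≡ 1ℤ
  -1^[n+n]≡1 n = ≡.trans (≡.cong (-1ℤ ℤ.^_) (≡.cong (n ℕ.+_) (≡.sym (ℕP.+-identityʳ n)))) (-1^[2*n]≡1 n)

  ¬2∣⇒odd : ∀ {n} → ¬ 2 ℕ∣.∣ n → ∃ λ w → n ≡ suc (2 ℕ.* w)
  ¬2∣⇒odd {zero}        2∤n = contradiction (ℕ∣._∣0 2) 2∤n
  ¬2∣⇒odd {suc zero}    _   = 0 , ≡.refl
  ¬2∣⇒odd {suc (suc n)} 2∤n with ¬2∣⇒odd {n} (λ 2∣n → 2∤n (ℕ∣.∣m∣n⇒∣m+n (ℕ∣.∣-refl {2}) 2∣n))
  ... | w , ≡.refl = suc w , ≡.cong (λ x → suc (suc x)) (≡.sym (ℕP.+-suc w (w ℕ.+ 0)))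

  prime≡2⊎odd : ∀ {p} → Prime p → p ≡ 2 ⊎ ¬ 2 ℕ∣.∣ p
  prime≡2⊎odd {p} pr with 2 ℕ∣.∣? p
  ... | no  2∤p = inj₂ 2∤p
  ... | yes 2∣p with prime⇒irreducible pr 2∣p
  ...   | inj₁ ()
  ...   | inj₂ 2≡p = inj₁ (≡.sym 2≡p)

  -1^[odd*x] : ∀ {m} → ¬ 2 ℕ∣.∣ m → ∀ x → -1ℤ ℤ.^ (m ℕ.* x) ≡ -1ℤ ℤ.^ x
  -1^[odd*x] 2∤m x with ¬2∣⇒odd 2∤m
  ... | w , ≡.refl = begin
    -1ℤ ℤ.^ (x ℕ.+ 2 ℕ.* w ℕ.* x)        ≡⟨ ℤP.^-distribˡ-+-* -1ℤ x (2 ℕ.* w ℕ.* x) ⟩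
    -1ℤ ℤ.^ x * -1ℤ ℤ.^ (2 ℕ.* w ℕ.* x)    ≡⟨ ≡.cong (λ e → -1ℤ ℤ.^ x * -1ℤ ℤ.^ e) (ℕP.*-assoc 2 w x) ⟩
    -1ℤ ℤ.^ x * -1ℤ ℤ.^ (2 ℕ.* (w ℕ.* x))  ≡⟨ ≡.cong (λ y → -1ℤ ℤ.^ x * y) (-1^[2*n]≡1 (w ℕ.* x)) ⟩
    -1ℤ ℤ.^ x * 1ℤ                        ≡⟨ ℤP.*-identityʳ (-1ℤ ℤ.^ x) ⟩
    -1ℤ ℤ.^ x                             ∎
    where open ≡.≡-Reasoning

  -1^[odd^j*x] : ∀ {m} → ¬ 2 ℕ∣.∣ m → ∀ j x → -1ℤ ℤ.^ (m ℕ.^ j ℕ.* x) ≡ -1ℤ ℤ.^ x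
  -1^[odd^j*x]     2∤m zero    x = ≡.cong (-1ℤ ℤ.^_) (ℕP.*-identityˡ x)
  -1^[odd^j*x] {m} 2∤m (suc j) x = ≡.trans (≡.cong (-1ℤ ℤ.^_) (ℕP.*-assoc m (m ℕ.^ j) x))
    (≡.trans (-1^[odd*x] 2∤m (m ℕ.^ j ℕ.* x)) (-1^[odd^j*x] 2∤m j x))

  -1≡1-mod-2 : -1ℤ ≡ 1ℤ mod + 2
  -1≡1-mod-2 = congruent (divides -1ℤ ≡.refl)

  -1^e≡1-mod-2 : ∀ e → -1ℤ ℤ.^ e ≡ 1ℤ mod + 2
  -1^e≡1-mod-2 zero    = ≡⇒≡-mod ≡.refl
  -1^e≡1-mod-2 (suc e) = *-cong-mod -1≡1-mod-2 (-1^e≡1-mod-2 e)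

  -1^q≡-1-mod-p : ∀ {p} → Prime p → ∀ f → -1ℤ ℤ.^ (p ℕ.^ suc f) ≡ -1ℤ mod + p
  -1^q≡-1-mod-p {p} pr f with prime≡2⊎odd pr
  ... | inj₁ ≡.refl = ≡ₘ.sym
                        (≡ₘ.trans -1≡1-mod-2 (≡⇒≡-mod (≡.sym (-1^[2*n]≡1 (2 ℕ.^ f)))))
  ... | inj₂ 2∤p    =
    ≡⇒≡-mod (≡.trans (≡.cong (-1ℤ ℤ.^_) (≡.sym (ℕP.*-identityʳ (p ℕ.^ suc f)))) (-1^[odd^j*x] 2∤p (suc f) 1))

  -- For odd p this is an equality. For p = 2 the outer signs are 1, and the middle one is 1 if k > 0
  -- and 1 modulo 2 if k = 0.
  sign-congruence : ∀ {p} → Prime p → ∀ h k r s →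
    -1ℤ ℤ.^ (p ℕ.* s) * -1ℤ ℤ.^ ((r ℕ.* p ℕ.^ h ℕ.+ s) ℕ.* p ℕ.^ k) ≡ -1ℤ ℤ.^ (p ℕ.* r) mod + (p ℕ.^ suc k)
  sign-congruence pr h k r s with prime≡2⊎odd pr
  sign-congruence pr h zero r s | inj₁ ≡.refl = begin
    -1ℤ ℤ.^ (2 ℕ.* s) * -1ℤ ℤ.^ (E ℕ.* 1)  ≡⟨ ≡.cong (_* -1ℤ ℤ.^ (E ℕ.* 1)) (-1^[2*n]≡1 s) ⟩
    1ℤ * -1ℤ ℤ.^ (E ℕ.* 1)                 ≡⟨ ℤP.*-identityˡ (-1ℤ ℤ.^ (E ℕ.* 1)) ⟩
    -1ℤ ℤ.^ (E ℕ.* 1)                      ≈⟨ -1^e≡1-mod-2 (E ℕ.* 1) ⟩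
    1ℤ                                     ≡⟨ -1^[2*n]≡1 r ⟨
    -1ℤ ℤ.^ (2 ℕ.* r)                      ∎
    where
    open import Relation.Binary.Reasoning.Setoid (≡-mod-setoid (+ 2))
    E = r ℕ.* 2 ℕ.^ h ℕ.+ s
  sign-congruence pr h (suc k) r s | inj₁ ≡.refl = ≡⇒≡-mod (begin
    -1ℤ ℤ.^ (2 ℕ.* s) * -1ℤ ℤ.^ (E ℕ.* (2 ℕ.* 2 ℕ.^ k))
      ≡⟨ ≡.cong₂ _*_ (-1^[2*n]≡1 s) (≡.cong (-1ℤ ℤ.^_) (ℕ*.x∙yz≈y∙xz E 2 (2 ℕ.^ k))) ⟩
    1ℤ * -1ℤ ℤ.^ (2 ℕ.* (E ℕ.* 2 ℕ.^ k))
      ≡⟨ ≡.cong (1ℤ *_) (-1^[2*n]≡1 (E ℕ.* 2 ℕ.^ k)) ⟩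
    1ℤ
      ≡⟨ -1^[2*n]≡1 r ⟨
    -1ℤ ℤ.^ (2 ℕ.* r)
      ∎)
    where
    open ≡.≡-Reasoning
    E = r ℕ.* 2 ℕ.^ h ℕ.+ s
  sign-congruence {p} pr h k r s | inj₂ 2∤p = ≡⇒≡-mod (begin
    -1ℤ ℤ.^ (p ℕ.* s) * -1ℤ ℤ.^ (E ℕ.* p ℕ.^ k)
      ≡⟨ ≡.cong₂ _*_ (-1^[odd*x] 2∤p s) (≡.trans (≡.cong (-1ℤ ℤ.^_) (ℕP.*-comm E (p ℕ.^ k))) (-1^[odd^j*x] 2∤p k E)) ⟩
    -1ℤ ℤ.^ s * -1ℤ ℤ.^ (r ℕ.* p ℕ.^ h ℕ.+ s)
      ≡⟨ ≡.cong (-1ℤ ℤ.^ s *_) (ℤP.^-distribˡ-+-* -1ℤ (r ℕ.* p ℕ.^ h) s) ⟩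
    -1ℤ ℤ.^ s * (-1ℤ ℤ.^ (r ℕ.* p ℕ.^ h) * -1ℤ ℤ.^ s)
      ≡⟨ ≡.cong (λ x → -1ℤ ℤ.^ s * (x * -1ℤ ℤ.^ s))
                (≡.trans (≡.cong (-1ℤ ℤ.^_) (ℕP.*-comm r (p ℕ.^ h))) (-1^[odd^j*x] 2∤p h r)) ⟩
    -1ℤ ℤ.^ s * (-1ℤ ℤ.^ r * -1ℤ ℤ.^ s)
      ≡⟨ ℤ*.x∙yz≈y∙xz (-1ℤ ℤ.^ s) (-1ℤ ℤ.^ r) (-1ℤ ℤ.^ s) ⟩
    -1ℤ ℤ.^ r * (-1ℤ ℤ.^ s * -1ℤ ℤ.^ s)
      ≡⟨ ≡.cong (-1ℤ ℤ.^ r *_) (≡.trans (≡.sym (ℤP.^-distribˡ-+-* -1ℤ s s)) (-1^[n+n]≡1 s)) ⟩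
    -1ℤ ℤ.^ r * 1ℤ
      ≡⟨ ℤP.*-identityʳ (-1ℤ ℤ.^ r) ⟩
    -1ℤ ℤ.^ r
      ≡⟨ -1^[odd*x] 2∤p r ⟨
    -1ℤ ℤ.^ (p ℕ.* r)
      ∎)
    where
    open ≡.≡-Reasoning
    E = r ℕ.* p ℕ.^ h ℕ.+ s

  𝟙[_∣_] : ℕ → ℕ → ℤ
  𝟙[ d ∣ x ] with d ℕ∣.∣? x
  ... | yes _ = 1ℤ
  ... | no  _ = 0ℤ

  𝟙-yes : ∀ {d x} → d ℕ∣.∣ x → 𝟙[ d ∣ x ] ≡ 1ℤ
  𝟙-yes {d} {x} d∣x with d ℕ∣.∣? x
  ... | yes _   = ≡.refl
  ... | no  d∤x = contradiction d∣x d∤x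

  𝟙-no : ∀ {d x} → ¬ d ℕ∣.∣ x → 𝟙[ d ∣ x ] ≡ 0ℤ
  𝟙-no {d} {x} d∤x with d ℕ∣.∣? x
  ... | yes d∣x = contradiction d∣x d∤x
  ... | no  _   = ≡.refl

  𝟙-cong : ∀ {d x y} → (d ℕ∣.∣ x → d ℕ∣.∣ y) → (d ℕ∣.∣ y → d ℕ∣.∣ x) → 𝟙[ d ∣ x ] ≡ 𝟙[ d ∣ y ]
  𝟙-cong {d} {x} {y} x⇒y y⇒x with d ℕ∣.∣? y
  ... | yes d∣y = 𝟙-yes (y⇒x d∣y)
  ... | no  d∤y = 𝟙-no (d∤y ∘ x⇒y)

  𝟙-coprime-* : ∀ {d m} → Coprime d m → ∀ x → 𝟙[ d ∣ m ℕ.* x ] ≡ 𝟙[ d ∣ x ]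
  𝟙-coprime-* {d} {m} d⊥m x = 𝟙-cong {d} {m ℕ.* x} {x} (coprime-divisor d⊥m) (ℕ∣.∣n⇒∣m*n m)

  sumUpTo : ℕ → (ℕ → ℤ) → ℤ
  sumUpTo zero    f = 0ℤ
  sumUpTo (suc n) f = f 0 + sumUpTo n (f ∘ suc)

  sumUpTo-cong : ∀ n {f g : ℕ → ℤ} → (∀ i → i < n → f i ≡ g i) → sumUpTo n f ≡ sumUpTo n g
  sumUpTo-cong zero    f≡g = ≡.refl
  sumUpTo-cong (suc n) f≡g =
    ≡.cong₂ _+_ (f≡g 0 (ℕ.s≤s ℕ.z≤n)) (sumUpTo-cong n (λ i i<n → f≡g (suc i) (ℕ.s≤s i<n)))

  sumUpTo-vanishing : ∀ n {f : ℕ → ℤ} → (∀ i → i < n → f i ≡ 0ℤ) → sumUpTo n f ≡ 0ℤ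
  sumUpTo-vanishing zero    f≡0 = ≡.refl
  sumUpTo-vanishing (suc n) f≡0 =
    ≡.cong₂ _+_ (f≡0 0 (ℕ.s≤s ℕ.z≤n)) (sumUpTo-vanishing n (λ i i<n → f≡0 (suc i) (ℕ.s≤s i<n)))

  sumUpTo-+ : ∀ m n (f : ℕ → ℤ) → sumUpTo (m ℕ.+ n) f ≡ sumUpTo m f + sumUpTo n (λ i → f (m ℕ.+ i))
  sumUpTo-+ zero    n f = ≡.sym (ℤP.+-identityˡ _)
  sumUpTo-+ (suc m) n f = ≡.trans (≡.cong (λ x → f 0 + x) (sumUpTo-+ m n (f ∘ suc))) (≡.sym (ℤP.+-assoc (f 0) _ _))

  foldr-map-applyUpTo : ∀ (g : ℕ → ℤ) (f : ℕ → ℕ) n → foldr _+_ 0ℤ (map g (applyUpTo f n)) ≡ sumUpTo n (g ∘ f)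
  foldr-map-applyUpTo g f zero    = ≡.refl
  foldr-map-applyUpTo g f (suc n) = ≡.cong (λ x → g (f 0) + x) (foldr-map-applyUpTo g (f ∘ suc) n)

  sumWindow-positive : ∀ N (g : ℤ → ℤ) → (∀ i → i ≤ N → g (+ i - + N) ≡ 0ℤ) →
                       sumWindow N g ≡ sumUpTo N (λ j → g (+ suc j))
  sumWindow-positive N g g≡0 = begin
    sumWindow N g
      ≡⟨ foldr-map-applyUpTo (λ i → g (+ i - + N)) id (suc (N ℕ.+ N)) ⟩
    sumUpTo (suc N ℕ.+ N) (λ i → g (+ i - + N))
      ≡⟨ sumUpTo-+ (suc N) N (λ i → g (+ i - + N)) ⟩
    sumUpTo (suc N) (λ i → g (+ i - + N)) + sumUpTo N (λ j → g (+ (suc N ℕ.+ j) - + N))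
      ≡⟨ ≡.cong₂ _+_ (sumUpTo-vanishing (suc N) (λ i i<1+N → g≡0 i (ℕP.≤-pred i<1+N)))
                     (sumUpTo-cong N (λ j _ → ≡.cong g (shift j))) ⟩
    0ℤ + sumUpTo N (λ j → g (+ suc j))
      ≡⟨ ℤP.+-identityˡ _ ⟩
    sumUpTo N (λ j → g (+ suc j))
      ∎
    where
    open ≡.≡-Reasoning
    cancel : ∀ a b → (1ℤ + a + b) - a ≡ 1ℤ + b
    cancel = solve-∀
    shift : ∀ j → + (suc N ℕ.+ j) - + N ≡ + suc j
    shift j = ≡.trans (≡.cong (_- + N) (ℤP.pos-+ (suc N) j)) (cancel (+ N) (+ j))

  sumUpTo-multiples : ∀ d .{{_ : NonZero d}} t (E : ℕ → ℤ) →
                      sumUpTo (t ℕ.* d) (λ x → 𝟙[ d ∣ x ] * E x) ≡ sumUpTo t (λ j → E (j ℕ.* d))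
  sumUpTo-multiples d zero    E = ≡.refl
  sumUpTo-multiples d@(suc d′) (suc t) E = begin
    sumUpTo (d ℕ.+ t ℕ.* d) (λ x → 𝟙[ d ∣ x ] * E x)
      ≡⟨ sumUpTo-+ d (t ℕ.* d) (λ x → 𝟙[ d ∣ x ] * E x) ⟩
    sumUpTo d (λ x → 𝟙[ d ∣ x ] * E x) + sumUpTo (t ℕ.* d) (λ y → 𝟙[ d ∣ d ℕ.+ y ] * E (d ℕ.+ y))
      ≡⟨ ≡.cong₂ _+_ first-block (sumUpTo-cong (t ℕ.* d) (λ y _ → ≡.cong (_* E (d ℕ.+ y)) (𝟙[d∣d+y]≡𝟙[d∣y] y))) ⟩
    E 0 + sumUpTo (t ℕ.* d) (λ y → 𝟙[ d ∣ y ] * E (d ℕ.+ y))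
      ≡⟨ ≡.cong (λ x → E 0 + x) (sumUpTo-multiples d t (E ∘ (d ℕ.+_))) ⟩
    E 0 + sumUpTo t (λ j → E (d ℕ.+ j ℕ.* d))
      ∎
    where
    open ≡.≡-Reasoning
    𝟙[d∣d+y]≡𝟙[d∣y] : ∀ y → 𝟙[ d ∣ d ℕ.+ y ] ≡ 𝟙[ d ∣ y ]
    𝟙[d∣d+y]≡𝟙[d∣y] y =
      𝟙-cong {d} {d ℕ.+ y} {y} (λ d∣d+y → ℕ∣.∣m+n∣m⇒∣n d∣d+y ℕ∣.∣-refl) (ℕ∣.∣m∣n⇒∣m+n ℕ∣.∣-refl)
    first-block : sumUpTo d (λ x → 𝟙[ d ∣ x ] * E x) ≡ E 0
    first-block = begin
      𝟙[ d ∣ 0 ] * E 0 + sumUpTo d′ (λ i → 𝟙[ d ∣ suc i ] * E (suc i))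
        ≡⟨ ≡.cong₂ _+_ (≡.trans (≡.cong (_* E 0) (𝟙-yes (ℕ∣._∣0 d))) (ℤP.*-identityˡ (E 0)))
                       (sumUpTo-vanishing d′ (λ i i<d′ → ≡.trans (≡.cong (_* E (suc i)) (𝟙-no (λ d∣1+i →
                          ℕP.<⇒≱ (ℕ.s≤s i<d′) (ℕ∣.∣⇒≤ d∣1+i)))) (ℤP.*-zeroˡ (E (suc i))))) ⟩
      E 0 + 0ℤ
        ≡⟨ ℤP.+-identityʳ (E 0) ⟩
      E 0
        ∎

  sumUpTo-support : ∀ M r m (f : ℕ → ℤ) → r ℕ.+ m ≤ M → (∀ x → x < r → f x ≡ 0ℤ) →
                    (∀ y → f (r ℕ.+ (m ℕ.+ y)) ≡ 0ℤ) → sumUpTo M f ≡ sumUpTo m (λ y → f (r ℕ.+ y))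
  sumUpTo-support M r m f r+m≤M below above with ℕP.m≤n⇒∃[o]m+o≡n r+m≤M
  ... | rest , ≡.refl = begin
    sumUpTo (r ℕ.+ m ℕ.+ rest) f
      ≡⟨ ≡.cong (λ l → sumUpTo l f) (ℕP.+-assoc r m rest) ⟩
    sumUpTo (r ℕ.+ (m ℕ.+ rest)) f
      ≡⟨ sumUpTo-+ r (m ℕ.+ rest) f ⟩
    sumUpTo r f + sumUpTo (m ℕ.+ rest) (λ y → f (r ℕ.+ y))
      ≡⟨ ≡.cong₂ _+_ (sumUpTo-vanishing r below) (sumUpTo-+ m rest (λ y → f (r ℕ.+ y))) ⟩
    0ℤ + (sumUpTo m (λ y → f (r ℕ.+ y)) + sumUpTo rest (λ z → f (r ℕ.+ (m ℕ.+ z))))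
      ≡⟨ ℤP.+-identityˡ _ ⟩
    sumUpTo m (λ y → f (r ℕ.+ y)) + sumUpTo rest (λ z → f (r ℕ.+ (m ℕ.+ z)))
      ≡⟨ ≡.cong (λ x → sumUpTo m (λ y → f (r ℕ.+ y)) + x) (sumUpTo-vanishing rest (λ z _ → above z)) ⟩
    sumUpTo m (λ y → f (r ℕ.+ y)) + 0ℤ
      ≡⟨ ℤP.+-identityʳ _ ⟩
    sumUpTo m (λ y → f (r ℕ.+ y))
      ∎
    where open ≡.≡-Reasoning

  module _ (n : ℕ) {r : ℕ} .{{_ : NonZero r}} where

    binomZ-below : ∀ {x} → x < r → binomZ n (+ x - + r) ≡ 0ℤ
    binomZ-below {x} x<r with ℕP.m≤n⇒∃[o]m+o≡n x<r
    ... | t , ≡.refl = ≡.cong (binomZ n) (≡.trans (≡.cong (λ y → + x - y) (ℤP.pos-+ (suc x) t)) (cancel (+ x) (+ t)))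
      where
      cancel : ∀ a b → a - (1ℤ + a + b) ≡ - (1ℤ + b)
      cancel = solve-∀

    binomZ-shift : ∀ y → binomZ n (+ (r ℕ.+ y) - + r) ≡ + (n choose y)
    binomZ-shift y = ≡.cong (binomZ n) (≡.trans (≡.cong (_- + r) (ℤP.pos-+ r y)) (cancel (+ r) (+ y)))
      where
      cancel : ∀ a b → (a + b) - a ≡ b
      cancel = solve-∀

  binomSum≡∑𝟙 : ∀ n d r .{{_ : NonZero d}} .{{_ : NonZero r}} →
                binomSum n d r ≡ sumUpTo (suc n) (λ k → + (n choose k) * 𝟙[ d ∣ r ℕ.+ k ])
  binomSum≡∑𝟙 n d r@(suc r′) = begin
    binomSum n d r
      ≡⟨ sumWindow-positive N g negative-part ⟩
    sumUpTo N (λ j → g (+ suc j))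
      ≡⟨ sumUpTo-cong N (λ j _ → ≡.cong (λ z → binomZ n (z - + r)) (≡.sym (ℤP.pos-* (suc j) d))) ⟩
    sumUpTo N (λ j → E (suc j ℕ.* d))
      ≡⟨ ℤP.+-identityˡ _ ⟨
    sumUpTo (suc N) (λ j → E (j ℕ.* d))
      ≡⟨ sumUpTo-multiples d (suc N) E ⟨
    sumUpTo (suc N ℕ.* d) (λ x → 𝟙[ d ∣ x ] * E x)
      ≡⟨ sumUpTo-support (suc N ℕ.* d) r (suc n) (λ x → 𝟙[ d ∣ x ] * E x) support-bound
           (λ x x<r → ≡.trans (≡.cong (𝟙[ d ∣ x ] *_) (binomZ-below n x<r)) (ℤP.*-zeroʳ 𝟙[ d ∣ x ]))
           (λ y → ≡.trans (≡.cong (𝟙[ d ∣ r ℕ.+ (suc n ℕ.+ y) ] *_) (≡.trans (binomZ-shift n (suc n ℕ.+ y))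
                    (≡.cong +_ (k>n⇒nCk≡0 (ℕ.s≤s (ℕP.m≤m+n n y)))))) (ℤP.*-zeroʳ 𝟙[ d ∣ r ℕ.+ (suc n ℕ.+ y) ])) ⟩
    sumUpTo (suc n) (λ k → 𝟙[ d ∣ r ℕ.+ k ] * E (r ℕ.+ k))
      ≡⟨ sumUpTo-cong (suc n) (λ k _ → ≡.trans (≡.cong (𝟙[ d ∣ r ℕ.+ k ] *_) (binomZ-shift n k))
                                              (ℤP.*-comm 𝟙[ d ∣ r ℕ.+ k ] (+ (n choose k)))) ⟩
    sumUpTo (suc n) (λ k → + (n choose k) * 𝟙[ d ∣ r ℕ.+ k ])
      ∎
    where
    open ≡.≡-Reasoning
    N = n ℕ.+ r
    g : ℤ → ℤ
    g b = binomZ n (b * + d - + r)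
    E : ℕ → ℤ
    E x = binomZ n (+ x - + r)
    negative-part : ∀ i → i ≤ N → g (+ i - + N) ≡ 0ℤ
    negative-part i i≤N with ℕP.m≤n⇒∃[o]m+o≡n i≤N
    ... | t , i+t≡N = ≡.cong (binomZ n) (begin
      (+ i - + N) * + d - + r
        ≡⟨ ≡.cong (λ z → (+ i - z) * + d - + r) (≡.trans (≡.cong +_ (≡.sym i+t≡N)) (ℤP.pos-+ i t)) ⟩
      (+ i - (+ i + + t)) * + d - + r
        ≡⟨ cancel (+ i) (+ t) (+ d) (+ r) ⟩
      - (+ t * + d + + r)
        ≡⟨ ≡.cong -_ (≡.trans (≡.cong (_+ + r) (≡.sym (ℤP.pos-* t d))) (≡.sym (ℤP.pos-+ (t ℕ.* d) r))) ⟩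
      - + (t ℕ.* d ℕ.+ suc r′)
        ≡⟨ ≡.cong (λ z → - + z) (ℕP.+-suc (t ℕ.* d) r′) ⟩
      -[1+ t ℕ.* d ℕ.+ r′ ]
        ∎)
      where
      cancel : ∀ a b c e → (a - (a + b)) * c - e ≡ - (b * c + e)
      cancel = solve-∀
    support-bound : r ℕ.+ suc n ≤ suc N ℕ.* d
    support-bound = ≡.subst (ℕ._≤ suc N ℕ.* d) (≡.trans (≡.cong suc (ℕP.+-comm n r)) (≡.sym (ℕP.+-suc r n)))
                            (ℕP.m≤m*n (suc N) d)

  open Matrices ℤP.+-*-commutativeRing

  ∑-const : ∀ n c → ∑[ i < n ] c ≡ + n * c
  ∑-const zero    c = ≡.sym (ℤP.*-zeroˡ c)
  ∑-const (suc n) c = ≡.trans (≡.cong (λ x → c + x) (∑-const n c)) (≡.sym (ℤP.suc-* (+ n) c))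

  ∑-sumUpTo : ∀ n (f : ℕ → ℤ) → ∑[ k < n ] f (toℕ k) ≡ sumUpTo n f
  ∑-sumUpTo zero    f = ≡.refl
  ∑-sumUpTo (suc n) f = ≡.cong (λ x → f 0 + x) (∑-sumUpTo n (f ∘ suc))

  ∑-cong-mod : ∀ {m n} {f g : Fin n → ℤ} → (∀ i → f i ≡ g i mod m) → ∑[ i < n ] f i ≡ ∑[ i < n ] g i mod m
  ∑-cong-mod {n = zero}  _   = ≡⇒≡-mod ≡.refl
  ∑-cong-mod {n = suc n} f≡g = +-cong-mod (f≡g zero) (∑-cong-mod (f≡g ∘ suc))

  module _ {n : ℕ} where

    open import Algebra.Properties.Semiring.Exp (Ring.semiring (matrixRing n)) public
      using () renaming (_^_ to infixr 8 _^ᴹ_)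
    open import Algebra.Properties.Semiring.Mult (Ring.semiring (matrixRing n)) public
      using () renaming (_×_ to infixr 8 _×ᴹ_)
    open import Algebra.Properties.Semiring.Sum (Ring.semiring (matrixRing n)) public
      using () renaming (sum to ∑ᴹ)

    infix 4 _≋_mod_
    _≋_mod_ : Matrix n → Matrix n → ℤ → Set
    A ≋ B mod m = ∀ i j → A i j ≡ B i j mod m

    module _ {m : ℤ} where

      ≋⇒≋-mod : ∀ {A B} → A ≋ B → A ≋ B mod m
      ≋⇒≋-mod A≋B i j = ≡⇒≡-mod (A≋B i j)

      ≋-mod-isEquivalence : IsEquivalence (λ A B → A ≋ B mod m)
      ≋-mod-isEquivalence = record
        { refl  = λ i j → E.refl
        ; sym   = λ A≋B i j → E.sym (A≋B i j)
        ; trans = λ A≋B B≋C i j → E.trans (A≋B i j) (B≋C i j)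
        }
        where module E = IsEquivalence (≡-mod-isEquivalence {m})

      opaque
        unfolding _+ᴹ_ _*ᴹ_ -ᴹ_ _∙_

        +ᴹ-cong-mod : ∀ {A A′ B B′} → A ≋ A′ mod m → B ≋ B′ mod m → A +ᴹ B ≋ A′ +ᴹ B′ mod m
        +ᴹ-cong-mod A≋A′ B≋B′ i j = +-cong-mod (A≋A′ i j) (B≋B′ i j)

        *ᴹ-cong-mod : ∀ {A A′ B B′} → A ≋ A′ mod m → B ≋ B′ mod m → A *ᴹ B ≋ A′ *ᴹ B′ mod m
        *ᴹ-cong-mod A≋A′ B≋B′ i j = ∑-cong-mod (λ k → *-cong-mod (A≋A′ i k) (B≋B′ k j))

        -ᴹ-cong-mod : ∀ {A A′} → A ≋ A′ mod m → -ᴹ A ≋ -ᴹ A′ mod m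
        -ᴹ-cong-mod A≋A′ i j = -‿cong-mod (A≋A′ i j)

        ∙-cong-mod : ∀ {a a′ A A′} → a ≡ a′ mod m → A ≋ A′ mod m → a ∙ A ≋ a′ ∙ A′ mod m
        ∙-cong-mod a≡a′ A≋A′ i j = *-cong-mod a≡a′ (A≋A′ i j)

      ^ᴹ-cong-mod : ∀ {A A′} → A ≋ A′ mod m → ∀ k → A ^ᴹ k ≋ A′ ^ᴹ k mod m
      ^ᴹ-cong-mod A≋A′ zero    = IsEquivalence.refl ≋-mod-isEquivalence
      ^ᴹ-cong-mod A≋A′ (suc k) = *ᴹ-cong-mod A≋A′ (^ᴹ-cong-mod A≋A′ k)

      trace-cong-mod : ∀ {A B} → A ≋ B mod m → trace A ≡ trace B mod m
      trace-cong-mod A≋B = ∑-cong-mod (λ i → A≋B i i)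

    ≋-mod-setoid : ℤ → Setoid _ _
    ≋-mod-setoid m = record { isEquivalence = ≋-mod-isEquivalence {m} }

    ≋-mod-weaken : ∀ {m m′ A B} → m ∣ m′ → A ≋ B mod m′ → A ≋ B mod m
    ≋-mod-weaken m∣m′ A≋B i j = ≡-mod-weaken m∣m′ (A≋B i j)

    opaque
      unfolding _+ᴹ_ _*ᴹ_ -ᴹ_ 0ᴹ

      *ᴹ-≋0-mod : ∀ {m m′ A B} → A ≋ 0ᴹ mod m → B ≋ 0ᴹ mod m′ → A *ᴹ B ≋ 0ᴹ mod m * m′
      *ᴹ-≋0-mod A≋0 B≋0 i j = ≡ₘ.trans
        (∑-cong-mod (λ k → ≡0-mod-* (A≋0 i k) (B≋0 k j))) (≡⇒≡-mod (sum-replicate-zero n))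

      ≋-mod⇒-≋0-mod : ∀ {m A B} → A ≋ B mod m → A +ᴹ -ᴹ B ≋ 0ᴹ mod m
      ≋-mod⇒-≋0-mod A≋B i j = ∣⇒≡0-mod (divides-difference (A≋B i j))

      ∑ᴹ-≋0-mod : ∀ {m k} (t : Fin k → Matrix n) → (∀ l → t l ≋ 0ᴹ mod m) → ∑ᴹ t ≋ 0ᴹ mod m
      ∑ᴹ-≋0-mod {k = zero}  t t≋0 = IsEquivalence.refl ≋-mod-isEquivalence
      ∑ᴹ-≋0-mod {k = suc k} t t≋0 = IsEquivalence.trans ≋-mod-isEquivalence
        (+ᴹ-cong-mod (t≋0 zero) (∑ᴹ-≋0-mod (t ∘ suc) (t≋0 ∘ suc))) (≋⇒≋-mod (λ _ _ → ≡.refl))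

      ×ᴹ-entry : ∀ k A (i j : Fin n) → (k ×ᴹ A) i j ≡ + k * A i j
      ×ᴹ-entry zero    A i j = ≡.refl
      ×ᴹ-entry (suc k) A i j = ≡.trans (≡.cong (λ x → A i j + x) (×ᴹ-entry k A i j)) (≡.sym (ℤP.suc-* (+ k) (A i j)))

      ×ᴹ-≋0-mod : ∀ {d k} A → d ℕ∣.∣ k → k ×ᴹ A ≋ 0ᴹ mod + d
      ×ᴹ-≋0-mod {d} {k} A (ℕ∣.divides c ≡.refl) i j = ∣⇒≡0-mod (divides (+ c * A i j) (begin
        ((c ℕ.* d) ×ᴹ A) i j  ≡⟨ ×ᴹ-entry (c ℕ.* d) A i j ⟩
        + (c ℕ.* d) * A i j   ≡⟨ ≡.cong (_* A i j) (ℤP.pos-* c d) ⟩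
        + c * + d * A i j     ≡⟨ commute-last (+ c) (+ d) (A i j) ⟩
        + c * A i j * + d     ∎))
        where
        open ≡.≡-Reasoning
        commute-last : ∀ x y z → x * y * z ≡ x * z * y
        commute-last = solve-∀

    trace-×ᴹ : ∀ k A → trace (k ×ᴹ A) ≡ + k * trace A
    trace-×ᴹ k A = ≡.trans (sum-cong-≗ {n} (λ i → ×ᴹ-entry k A i i)) (≡.sym (*-distribˡ-sum {n} (+ k) (λ i → A i i)))

    trace-∑ᴹ : ∀ {k} (t : Fin k → Matrix n) → trace (∑ᴹ t) ≡ ∑[ l < k ] trace (t l)
    trace-∑ᴹ {zero}  t = trace-0ᴹ {n}
    trace-∑ᴹ {suc k} t =
      ≡.trans (trace-+ᴹ {n} (t zero) (∑ᴹ (t ∘ suc))) (≡.cong (λ x → trace (t zero) + x) (trace-∑ᴹ (t ∘ suc)))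

    ∙-^ᴹ : ∀ a (A : Matrix n) k → (a ∙ A) ^ᴹ k ≋ (a ℤ.^ k) ∙ (A ^ᴹ k)
    ∙-^ᴹ a A zero    = M.sym (∙-identityˡ 1ᴹ)
      where module M = Ring (matrixRing n)
    ∙-^ᴹ a A (suc k) = M.trans (M.*-congˡ {a ∙ A} (∙-^ᴹ a A k)) (∙-*ᴹ-∙ a (a ℤ.^ k) A (A ^ᴹ k))
      where module M = Ring (matrixRing n)

  module ≋ₘ {n : ℕ} {m : ℤ} = Setoid (≋-mod-setoid {n} m)

  [1+k]*[1+n]C[1+k]≡[1+n]*nCk : ∀ n k → suc k ℕ.* (suc n choose suc k) ≡ suc n ℕ.* (n choose k)
  [1+k]*[1+n]C[1+k]≡[1+n]*nCk zero    zero    = ≡.refl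
  [1+k]*[1+n]C[1+k]≡[1+n]*nCk zero    (suc k) =
    ≡.trans (≡.cong (suc (suc k) ℕ.*_) (k>n⇒nCk≡0 {1} {suc (suc k)} (ℕ.s≤s (ℕ.s≤s ℕ.z≤n))))
            (≡.trans (ℕP.*-zeroʳ (suc (suc k))) (≡.sym (≡.cong (1 ℕ.*_) (k>n⇒nCk≡0 {0} {suc k} (ℕ.s≤s ℕ.z≤n)))))
  [1+k]*[1+n]C[1+k]≡[1+n]*nCk (suc n) zero    =
    ≡.trans (ℕP.+-identityʳ _) (≡.trans (nC1≡n (suc (suc n))) (≡.sym (ℕP.*-identityʳ (suc (suc n)))))
  [1+k]*[1+n]C[1+k]≡[1+n]*nCk (suc n) (suc k) = begin
    suc (suc k) ℕ.* (suc (suc n) choose suc (suc k))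
      ≡⟨ ≡.cong (suc (suc k) ℕ.*_) (nCk+nC[k+1]≡[n+1]C[k+1] (suc n) (suc k)) ⟨
    suc (suc k) ℕ.* (suc n choose suc k ℕ.+ suc n choose suc (suc k))
      ≡⟨ ℕP.*-distribˡ-+ (suc (suc k)) (suc n choose suc k) _ ⟩
    suc n choose suc k ℕ.+ suc k ℕ.* (suc n choose suc k) ℕ.+ suc (suc k) ℕ.* (suc n choose suc (suc k))
      ≡⟨ ≡.cong₂ (λ a b → suc n choose suc k ℕ.+ a ℕ.+ b)
                 ([1+k]*[1+n]C[1+k]≡[1+n]*nCk n k) ([1+k]*[1+n]C[1+k]≡[1+n]*nCk n (suc k)) ⟩
    suc n choose suc k ℕ.+ suc n ℕ.* (n choose k) ℕ.+ suc n ℕ.* (n choose suc k)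
      ≡⟨ ℕP.+-assoc (suc n choose suc k) _ _ ⟩
    suc n choose suc k ℕ.+ (suc n ℕ.* (n choose k) ℕ.+ suc n ℕ.* (n choose suc k))
      ≡⟨ ≡.cong (suc n choose suc k ℕ.+_) (ℕP.*-distribˡ-+ (suc n) (n choose k) (n choose suc k)) ⟨
    suc n choose suc k ℕ.+ suc n ℕ.* (n choose k ℕ.+ n choose suc k)
      ≡⟨ ≡.cong (λ x → suc n choose suc k ℕ.+ suc n ℕ.* x) (nCk+nC[k+1]≡[n+1]C[k+1] n k) ⟩
    suc (suc n) ℕ.* (suc n choose suc k)
      ∎
    where open ≡.≡-Reasoning

  p∣pCk : ∀ {p k} → Prime p → 0 ℕ.< k → k ℕ.< p → p ℕ∣.∣ p choose k
  p∣pCk {suc p} {suc k} pr _ k<p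
    with euclidsLemma (suc k) (suc p choose suc k) pr
           (ℕ∣.divides (p choose k) (≡.trans ([1+k]*[1+n]C[1+k]≡[1+n]*nCk p k) (ℕP.*-comm (suc p) (p choose k))))
  ... | inj₂ p∣C = p∣C
  ... | inj₁ p∣k = contradiction (ℕ∣.∣⇒≤ p∣k) (ℕP.<⇒≱ k<p)

  module _ {n : ℕ} where

    private
      module ℳ = Ring (matrixRing n)
    open CommutingElements (matrixRing n)
    open import Algebra.Properties.Semiring.Mult ℳ.semiring using (×-homo-1)
    import Algebra.Properties.Semiring.Sum ℳ.semiring as ∑ᴹ

    frobenius : ∀ {p} → Prime p → (X : Matrix n) → (X +ᴹ 1ᴹ) ^ᴹ p ≋ X ^ᴹ p +ᴹ 1ᴹ mod + p
    frobenius {zero}  pr X = contradiction pr ¬prime[0]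
    frobenius {suc p} pr X = begin
      (X +ᴹ 1ᴹ) ^ᴹ suc p
        ≈⟨ ≋⇒≋-mod (B.theorem (commute-1#ʳ X) (suc p)) ⟩
      term 0 +ᴹ ∑ᴹ {n} {suc p} (λ k → term (toℕ (suc k)))
        ≈⟨ ≋⇒≋-mod (ℳ.+-congˡ {term 0} (∑ᴹ.sum-init-last {p} (λ k → term (toℕ (suc k))))) ⟩
      term 0 +ᴹ (∑ᴹ {n} {p} (λ k → term (suc (toℕ (inject₁ k)))) +ᴹ term (toℕ (fromℕ (suc p))))
        ≈⟨ +ᴹ-cong-mod (≋⇒≋-mod first) (+ᴹ-cong-mod (∑ᴹ-≋0-mod _ middle) (≋⇒≋-mod last)) ⟩
      1ᴹ +ᴹ (0ᴹ +ᴹ X ^ᴹ suc p)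
        ≈⟨ ≋⇒≋-mod (ℳ.trans (ℳ.+-congˡ (ℳ.+-identityˡ (X ^ᴹ suc p))) (ℳ.+-comm _ _)) ⟩
      X ^ᴹ suc p +ᴹ 1ᴹ
        ∎
      where
      open import Relation.Binary.Reasoning.Setoid (≋-mod-setoid (+ suc p))
      module B = Algebra.Properties.Semiring.Binomial ℳ.semiring X 1ᴹ
      term : ℕ → Matrix n
      term k = (suc p choose k) ×ᴹ (X ^ᴹ k *ᴹ 1ᴹ ^ᴹ (suc p ℕ.∸ k))
      first : term 0 ≋ 1ᴹ
      first = ℳ.trans (×-homo-1 _) (ℳ.trans (ℳ.*-identityˡ _) (1#^n≈1# (suc p)))
      middle : ∀ k → term (suc (toℕ (inject₁ k))) ≋ 0ᴹ mod + suc p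
      middle k = ×ᴹ-≋0-mod _ (p∣pCk pr (ℕ.s≤s ℕ.z≤n)
        (ℕ.s≤s (≡.subst (ℕ._< p) (≡.sym (FinP.toℕ-inject₁ k)) (FinP.toℕ<n k))))
      last : term (toℕ (fromℕ (suc p))) ≋ X ^ᴹ suc p
      last rewrite FinP.toℕ-fromℕ p | nCn≡1 (suc p) | ℕP.n∸n≡0 p =
        ℳ.trans (×-homo-1 _) (ℳ.*-identityʳ _)

    frobenius-^ : ∀ {p} → Prime p → (X : Matrix n) → ∀ j → (X +ᴹ 1ᴹ) ^ᴹ (p ^ j) ≋ X ^ᴹ (p ^ j) +ᴹ 1ᴹ mod + p
    frobenius-^ pr X zero = ≋⇒≋-mod (ℳ.trans (ℳ.*-identityʳ _) (ℳ.+-congʳ (ℳ.sym (ℳ.*-identityʳ X))))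
    frobenius-^ {p} pr X (suc j) = begin
      (X +ᴹ 1ᴹ) ^ᴹ (p ^ suc j)          ≈⟨ ≋⇒≋-mod (x^[m*n]≈[x^n]^m (X +ᴹ 1ᴹ) p (p ^ j)) ⟩
      ((X +ᴹ 1ᴹ) ^ᴹ (p ^ j)) ^ᴹ p       ≈⟨ ^ᴹ-cong-mod (frobenius-^ pr X j) p ⟩
      (X ^ᴹ (p ^ j) +ᴹ 1ᴹ) ^ᴹ p         ≈⟨ frobenius pr (X ^ᴹ (p ^ j)) ⟩
      (X ^ᴹ (p ^ j)) ^ᴹ p +ᴹ 1ᴹ         ≈⟨ ≋⇒≋-mod (ℳ.+-congʳ (ℳ.sym (x^[m*n]≈[x^n]^m X p (p ^ j)))) ⟩
      X ^ᴹ (p ^ suc j) +ᴹ 1ᴹ            ∎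
      where open import Relation.Binary.Reasoning.Setoid (≋-mod-setoid (+ p))

    geometric-cong-mod : ∀ {m A A′ B B′} → A ≋ A′ mod m → B ≋ B′ mod m →
                         ∀ k → geometric A B k ≋ geometric A′ B′ k mod m
    geometric-cong-mod A≋A′ B≋B′ zero    = ≋ₘ.refl
    geometric-cong-mod A≋A′ B≋B′ (suc k) =
      +ᴹ-cong-mod (*ᴹ-cong-mod A≋A′ (geometric-cong-mod A≋A′ B≋B′ k)) (^ᴹ-cong-mod B≋B′ k)

    -- A^p = B^p + (A - B) · geometric A B p, and geometric A B p ≡ p · B^(p-1) ≡ 0 (mod p).
    lift-step : ∀ {m A B} p → Commute A B → A ≋ B mod + p → A ≋ B mod m → A ^ᴹ p ≋ B ^ᴹ p mod m * + p
    lift-step zero    _  _      _      = ≋ₘ.refl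
    lift-step {m} {A} {B} (suc p) AB A≡B[p] A≡B[m] = begin
      A ^ᴹ suc p
        ≈⟨ ≋⇒≋-mod (x^n≈y^n+[x-y]*geometric AB (suc p)) ⟩
      B ^ᴹ suc p +ᴹ (A +ᴹ -ᴹ B) *ᴹ geometric A B (suc p)
        ≈⟨ +ᴹ-cong-mod ≋ₘ.refl (*ᴹ-≋0-mod (≋-mod⇒-≋0-mod A≡B[m]) G≋0) ⟩
      B ^ᴹ suc p +ᴹ 0ᴹ
        ≈⟨ ≋⇒≋-mod (ℳ.+-identityʳ _) ⟩
      B ^ᴹ suc p
        ∎
      where
      open import Relation.Binary.Reasoning.Setoid (≋-mod-setoid (m * + suc p))
      G≋0 : geometric A B (suc p) ≋ 0ᴹ mod + suc p
      G≋0 = ≋ₘ.trans (geometric-cong-mod A≡B[p] ≋ₘ.refl (suc p))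
                     (≋ₘ.trans (≋⇒≋-mod (geometric-diagonal B p)) (×ᴹ-≋0-mod _ ℕ∣.∣-refl))

    lift : ∀ {A B} p → Commute A B → A ≋ B mod + p → ∀ j → A ^ᴹ (p ^ j) ≋ B ^ᴹ (p ^ j) mod + (p ^ suc j)
    lift {A} {B} p AB A≡B zero = ≡.subst (A ^ᴹ 1 ≋ B ^ᴹ 1 mod_) (≡.cong +_ (≡.sym (ℕP.*-identityʳ p)))
      (≋ₘ.trans (≋⇒≋-mod (ℳ.*-identityʳ A)) (≋ₘ.trans A≡B (≋⇒≋-mod (ℳ.sym (ℳ.*-identityʳ B)))))
    lift {A} {B} p AB A≡B (suc j) = ≡.subst (A ^ᴹ (p ^ suc j) ≋ B ^ᴹ (p ^ suc j) mod_) modulus (begin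
      A ^ᴹ (p ^ suc j)        ≈⟨ ≋⇒≋-mod (x^[m*n]≈[x^n]^m A p (p ^ j)) ⟩
      (A ^ᴹ (p ^ j)) ^ᴹ p     ≈⟨ lift-step p (commute-^ AB (p ^ j) (p ^ j)) (≋-mod-weaken p∣p^[1+j] IH) IH ⟩
      (B ^ᴹ (p ^ j)) ^ᴹ p     ≈⟨ ≋⇒≋-mod (ℳ.sym (x^[m*n]≈[x^n]^m B p (p ^ j))) ⟩
      B ^ᴹ (p ^ suc j)        ∎)
      where
      open import Relation.Binary.Reasoning.Setoid (≋-mod-setoid (+ (p ^ suc j) * + p))
      IH = lift p AB A≡B j
      p∣p^[1+j] : + p ∣ + (p ^ suc j)
      p∣p^[1+j] = ℤ∣.∣ᵤ⇒∣ (ℕ∣.m∣m*n (p ^ j))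
      modulus : + (p ^ suc j) * + p ≡ + (p ^ suc (suc j))
      modulus = ≡.trans (≡.sym (ℤP.pos-* (p ^ suc j) p)) (≡.cong +_ (ℕP.*-comm (p ^ suc j) p))

  -- ρ^ m is the m-th iterate of ρ : 0 ↦ 1 ↦ ⋯ ↦ d ↦ 1 in closed form, and C is the matrix of ρ.
  -- The tail 0 ↦ 1 makes e₀ a cyclic vector (C^b e₀ = e_b for b ≤ d) while keeping C^q = C.
  module RhoMatrix (d : ℕ) .{{_ : NonZero d}} where

    q : ℕ
    q = suc d

    ρ^ : ℕ → Fin q → Fin q
    ρ^ zero    j = j
    ρ^ (suc m) j = suc ((m ℕ.+ toℕ j) DM.mod d)

    C : Matrix q
    C = ⟦ ρ^ 1 ⟧

    private
      module M = Ring (matrixRing q)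

    toℕ-mod : ∀ x → toℕ (x DM.mod d) ≡ x % d
    toℕ-mod x = FinP.toℕ-fromℕ< (DM.m%n<n x d)

    [1+m%n]%n≡[1+m]%n : ∀ x → suc (x % d) % d ≡ suc x % d
    [1+m%n]%n≡[1+m]%n x = begin
      (1 ℕ.+ x % d) % d               ≡⟨ DM.%-distribˡ-+ 1 (x % d) d ⟩
      (1 % d ℕ.+ x % d % d) % d       ≡⟨ ≡.cong (λ y → (1 % d ℕ.+ y) % d) (DM.m%n%n≡m%n x d) ⟩
      (1 % d ℕ.+ x % d) % d           ≡⟨ DM.%-distribˡ-+ 1 x d ⟨
      (1 ℕ.+ x) % d                   ∎
      where open ≡.≡-Reasoning

    ρ^-suc : ∀ m j → ρ^ 1 (ρ^ m j) ≡ ρ^ (suc m) j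
    ρ^-suc zero    j = ≡.refl
    ρ^-suc (suc m) j = ≡.cong suc (FinP.toℕ-injective (begin
      toℕ ((suc (toℕ ((m ℕ.+ toℕ j) DM.mod d))) DM.mod d) ≡⟨ toℕ-mod _ ⟩
      suc (toℕ ((m ℕ.+ toℕ j) DM.mod d)) % d            ≡⟨ ≡.cong (λ y → suc y % d) (toℕ-mod (m ℕ.+ toℕ j)) ⟩
      suc ((m ℕ.+ toℕ j) % d) % d                       ≡⟨ [1+m%n]%n≡[1+m]%n (m ℕ.+ toℕ j) ⟩
      suc (m ℕ.+ toℕ j) % d                             ≡⟨ toℕ-mod (suc m ℕ.+ toℕ j) ⟨
      toℕ ((suc m ℕ.+ toℕ j) DM.mod d)                  ∎))
      where open ≡.≡-Reasoning

    C^≋⟦ρ^⟧ : ∀ m → C ^ᴹ m ≋ ⟦ ρ^ m ⟧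
    C^≋⟦ρ^⟧ zero          = 1ᴹ≋⟦id⟧
    C^≋⟦ρ^⟧ (suc m) i j =
      ≡.trans (M.trans (M.*-congˡ {C} (C^≋⟦ρ^⟧ m)) (*ᴹ-⟦⟧ C (ρ^ m)) i j) (≡.cong (δ i) (ρ^-suc m j))

    ρ^-period : ∀ j → ρ^ q j ≡ ρ^ 1 j
    ρ^-period j = ≡.cong suc (FinP.toℕ-injective (begin
      toℕ ((d ℕ.+ toℕ j) DM.mod d) ≡⟨ toℕ-mod (d ℕ.+ toℕ j) ⟩
      (d ℕ.+ toℕ j) % d            ≡⟨ DM.%-remove-+ˡ (toℕ j) ℕ∣.∣-refl ⟩
      toℕ j % d                    ≡⟨ toℕ-mod (toℕ j) ⟨
      toℕ (toℕ j DM.mod d)         ∎))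
      where open ≡.≡-Reasoning

    C^q≋C : C ^ᴹ q ≋ C
    C^q≋C i j = ≡.trans (C^≋⟦ρ^⟧ q i j) (≡.cong (δ i) (ρ^-period j))

    C^[q^t]≋C : ∀ t → C ^ᴹ (q ℕ.^ t) ≋ C
    C^[q^t]≋C zero    = M.*-identityʳ C
    C^[q^t]≋C (suc t) = M.trans (x^[m*n]≈[x^n]^m C q (q ℕ.^ t)) (M.trans (^-congˡ q (C^[q^t]≋C t)) C^q≋C)
      where
      open CommutingElements (matrixRing q)
      open import Algebra.Properties.Semiring.Exp M.semiring using (^-congˡ)

    ρ^-orbit : ∀ (b : Fin q) → ρ^ (toℕ b) zero ≡ b
    ρ^-orbit zero    = ≡.refl
    ρ^-orbit (suc b) = ≡.cong suc (FinP.toℕ-injective (begin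
      toℕ ((toℕ b ℕ.+ 0) DM.mod d) ≡⟨ toℕ-mod (toℕ b ℕ.+ 0) ⟩
      (toℕ b ℕ.+ 0) % d            ≡⟨ ≡.cong (_% d) (ℕP.+-identityʳ (toℕ b)) ⟩
      toℕ b % d                    ≡⟨ DM.m<n⇒m%n≡m (FinP.toℕ<n b) ⟩
      toℕ b                        ∎))
      where open ≡.≡-Reasoning

    C^-column₀ : ∀ (b : Fin q) i → (C ^ᴹ toℕ b) i zero ≡ δ i b
    C^-column₀ b i = ≡.trans (C^≋⟦ρ^⟧ (toℕ b) i zero) (≡.cong (δ i) (ρ^-orbit b))

    δ-mod : ∀ x (i : Fin d) → δ i ((x ℕ.+ toℕ i) DM.mod d) ≡ 𝟙[ d ∣ x ]
    δ-mod x i with d ℕ∣.∣? x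
    ... | yes d∣x = ≡.trans (≡.cong (δ i) (≡.sym (FinP.toℕ-injective i≡))) (δ-refl i)
      where
      i≡ : toℕ i ≡ toℕ ((x ℕ.+ toℕ i) DM.mod d)
      i≡ = ≡.sym (≡.trans (toℕ-mod (x ℕ.+ toℕ i)) (≡.trans (DM.%-remove-+ˡ (toℕ i) d∣x) (DM.m<n⇒m%n≡m (FinP.toℕ<n i))))
    ... | no d∤x  = δ-≢ (λ i≡ → d∤x (ℕ∣.divides ((x ℕ.+ toℕ i) / d) (ℕP.+-cancelʳ-≡ (toℕ i) x _ (begin
      x ℕ.+ toℕ i
        ≡⟨ DM.m≡m%n+[m/n]*n (x ℕ.+ toℕ i) d ⟩
      (x ℕ.+ toℕ i) % d ℕ.+ (x ℕ.+ toℕ i) / d ℕ.* d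
        ≡⟨ ≡.cong (ℕ._+ (x ℕ.+ toℕ i) / d ℕ.* d) (≡.trans (≡.sym (toℕ-mod _)) (≡.cong toℕ (≡.sym i≡))) ⟩
      toℕ i ℕ.+ (x ℕ.+ toℕ i) / d ℕ.* d
        ≡⟨ ℕP.+-comm (toℕ i) _ ⟩
      (x ℕ.+ toℕ i) / d ℕ.* d ℕ.+ toℕ i
        ∎))))
      where open ≡.≡-Reasoning

    trace-C^suc : ∀ m → trace (C ^ᴹ suc m) ≡ + d * 𝟙[ d ∣ suc m ]
    trace-C^suc m = begin
      trace (C ^ᴹ suc m)
        ≡⟨ trace-cong (C^≋⟦ρ^⟧ (suc m)) ⟩
      ∑[ j < q ] δ j (ρ^ (suc m) j)
        ≡⟨ ℤP.+-identityˡ _ ⟩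
      ∑[ i < d ] δ i ((m ℕ.+ suc (toℕ i)) DM.mod d)
        ≡⟨ sum-cong-≗ (λ i → ≡.cong (λ y → δ i (y DM.mod d)) (ℕP.+-suc m (toℕ i))) ⟩
      ∑[ i < d ] δ i ((suc m ℕ.+ toℕ i) DM.mod d)
        ≡⟨ sum-cong-≗ (δ-mod (suc m)) ⟩
      ∑[ i < d ] 𝟙[ d ∣ suc m ]
        ≡⟨ ∑-const d 𝟙[ d ∣ suc m ] ⟩
      + d * 𝟙[ d ∣ suc m ]
        ∎
      where open ≡.≡-Reasoning

    trace-C^ : ∀ e .{{_ : NonZero e}} → trace (C ^ᴹ e) ≡ + d * 𝟙[ d ∣ e ]
    trace-C^ (suc e) = trace-C^suc e

    trace-binomial : ∀ a b n .{{_ : NonZero a}} →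
      trace (C ^ᴹ a *ᴹ (C ^ᴹ b +ᴹ 1ᴹ) ^ᴹ n) ≡ + d * ∑[ k < suc n ] (+ (n choose toℕ k) * 𝟙[ d ∣ a ℕ.+ b ℕ.* toℕ k ])
    trace-binomial a@(suc _) b n = begin
      trace (C ^ᴹ a *ᴹ (C ^ᴹ b +ᴹ 1ᴹ) ^ᴹ n)
        ≡⟨ trace-cong (M.*-congˡ {C ^ᴹ a} (B.theorem (commute-1#ʳ (C ^ᴹ b)) n)) ⟩
      trace (C ^ᴹ a *ᴹ ∑ᴹ (B.binomialTerm n))
        ≡⟨ trace-cong (∑ᴹ.*-distribˡ-sum (C ^ᴹ a) (B.binomialTerm n)) ⟩
      trace (∑ᴹ (λ k → C ^ᴹ a *ᴹ B.binomialTerm n k))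
        ≡⟨ trace-∑ᴹ (λ k → C ^ᴹ a *ᴹ B.binomialTerm n k) ⟩
      ∑[ k < suc n ] trace (C ^ᴹ a *ᴹ B.binomialTerm n k)
        ≡⟨ sum-cong-≗ {suc n} (term ∘ toℕ) ⟩
      ∑[ k < suc n ] (+ d * (+ (n choose toℕ k) * 𝟙[ d ∣ a ℕ.+ b ℕ.* toℕ k ]))
        ≡⟨ *-distribˡ-sum {suc n} (+ d) (λ k → + (n choose toℕ k) * 𝟙[ d ∣ a ℕ.+ b ℕ.* toℕ k ]) ⟨
      + d * ∑[ k < suc n ] (+ (n choose toℕ k) * 𝟙[ d ∣ a ℕ.+ b ℕ.* toℕ k ])
        ∎
      where
      open ≡.≡-Reasoning
      open CommutingElements (matrixRing q)
      open import Algebra.Properties.Semiring.Exp M.semiring using (^-homo-*; ^-assocʳ)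
      open import Algebra.Properties.Semiring.Mult M.semiring using (×-comm-*)
      import Algebra.Properties.Semiring.Sum M.semiring as ∑ᴹ
      module B = Algebra.Properties.Semiring.Binomial M.semiring (C ^ᴹ b) 1ᴹ
      power : ∀ k → C ^ᴹ a *ᴹ ((C ^ᴹ b) ^ᴹ k *ᴹ 1ᴹ ^ᴹ (n ℕ.∸ k)) ≋ C ^ᴹ (a ℕ.+ b ℕ.* k)
      power k = M.trans (M.*-congˡ {C ^ᴹ a} (M.trans (M.*-cong (^-assocʳ C b k) (1#^n≈1# (n ℕ.∸ k))) (M.*-identityʳ _)))
                        (M.sym (^-homo-* C a (b ℕ.* k)))
      term : ∀ k → trace (C ^ᴹ a *ᴹ (n choose k) ×ᴹ ((C ^ᴹ b) ^ᴹ k *ᴹ 1ᴹ ^ᴹ (n ℕ.∸ k)))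
                 ≡ + d * (+ (n choose k) * 𝟙[ d ∣ a ℕ.+ b ℕ.* k ])
      term k = begin
        trace (C ^ᴹ a *ᴹ (n choose k) ×ᴹ _)
          ≡⟨ trace-cong (×-comm-* (n choose k) (C ^ᴹ a) _) ⟩
        trace ((n choose k) ×ᴹ (C ^ᴹ a *ᴹ _))
          ≡⟨ trace-×ᴹ (n choose k) _ ⟩
        + (n choose k) * trace (C ^ᴹ a *ᴹ _)
          ≡⟨ ≡.cong (+ (n choose k) *_) (≡.trans (trace-cong (power k)) (trace-C^ (a ℕ.+ b ℕ.* k))) ⟩
        + (n choose k) * (+ d * 𝟙[ d ∣ a ℕ.+ b ℕ.* k ])
          ≡⟨ ℤ*.x∙yz≈y∙xz (+ (n choose k)) (+ d) _ ⟩
        + d * (+ (n choose k) * 𝟙[ d ∣ a ℕ.+ b ℕ.* k ])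
          ∎

  module TeichmüllerLift {p : ℕ} (pr : Prime p) (f d : ℕ) .{{_ : NonZero d}} (q≡p^[1+f] : suc d ≡ p ^ suc f) where

    open RhoMatrix d public
    open CommutingElements (matrixRing q)
    private
      module M = Ring (matrixRing q)
    open import Algebra.Properties.Semiring.Exp M.semiring using (^-congˡ; ^-congʳ)
    open import Algebra.Properties.Ring (matrixRing q) using (-‿+-comm; -‿involutive)

    Z : Matrix q
    Z = -ᴹ (C +ᴹ 1ᴹ)

    Z∈C″ : Bicommutant C Z
    Z∈C″ = bicommutant-- (bicommutant-+ (bicommutant-self C) (bicommutant-1# C))

    -[x+1]+1≈-x : ∀ X → -ᴹ (X +ᴹ 1ᴹ) +ᴹ 1ᴹ ≋ -ᴹ X
    -[x+1]+1≈-x X = begin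
      -ᴹ (X +ᴹ 1ᴹ) +ᴹ 1ᴹ          ≈⟨ M.+-congʳ (-‿+-comm X 1ᴹ) ⟨
      (-ᴹ X +ᴹ -ᴹ 1ᴹ) +ᴹ 1ᴹ       ≈⟨ M.+-assoc (-ᴹ X) (-ᴹ 1ᴹ) 1ᴹ ⟩
      -ᴹ X +ᴹ (-ᴹ 1ᴹ +ᴹ 1ᴹ)       ≈⟨ M.+-congˡ (M.-‿inverseˡ 1ᴹ) ⟩
      -ᴹ X +ᴹ 0ᴹ                  ≈⟨ M.+-identityʳ (-ᴹ X) ⟩
      -ᴹ X                        ∎
      where open import Relation.Binary.Reasoning.Setoid M.setoid

    mixedPower : Matrix q → ℕ → ℕ → Matrix q
    mixedPower X a s = X ^ᴹ a *ᴹ (X +ᴹ 1ᴹ) ^ᴹ s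

    mixedPower∈C″ : ∀ {X} → Bicommutant C X → ∀ a s → Bicommutant C (mixedPower X a s)
    mixedPower∈C″ X∈C″ a s = bicommutant-* (bicommutant-^ X∈C″ a) (bicommutant-^ (bicommutant-+ X∈C″ (bicommutant-1# C)) s)

    frobenius-q : ∀ (X : Matrix q) → (X +ᴹ 1ᴹ) ^ᴹ q ≋ X ^ᴹ q +ᴹ 1ᴹ mod + p
    frobenius-q X = ≡.subst (λ e → (X +ᴹ 1ᴹ) ^ᴹ e ≋ X ^ᴹ e +ᴹ 1ᴹ mod + p) (≡.sym q≡p^[1+f]) (frobenius-^ pr X (suc f))

    Z^q≡Z : Z ^ᴹ q ≋ Z mod + p
    Z^q≡Z = begin
      Z ^ᴹ q                          ≈⟨ ≋⇒≋-mod (^-congˡ q (-ᴹ≋-1∙ (C +ᴹ 1ᴹ))) ⟩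
      (-1ℤ ∙ (C +ᴹ 1ᴹ)) ^ᴹ q          ≈⟨ ≋⇒≋-mod (∙-^ᴹ -1ℤ (C +ᴹ 1ᴹ) q) ⟩
      (-1ℤ ℤ.^ q) ∙ (C +ᴹ 1ᴹ) ^ᴹ q    ≈⟨ ∙-cong-mod -1^q≡-1 (frobenius-q C) ⟩
      -1ℤ ∙ (C ^ᴹ q +ᴹ 1ᴹ)            ≈⟨ ∙-cong-mod (≡ₘ.refl {x = -1ℤ}) (≋⇒≋-mod (M.+-congʳ C^q≋C)) ⟩
      -1ℤ ∙ (C +ᴹ 1ᴹ)                 ≈⟨ ≋⇒≋-mod (-ᴹ≋-1∙ (C +ᴹ 1ᴹ)) ⟨
      Z                               ∎
      where
      open import Relation.Binary.Reasoning.Setoid (≋-mod-setoid (+ p))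
      -1^q≡-1 : -1ℤ ℤ.^ q ≡ -1ℤ mod + p
      -1^q≡-1 = ≡.subst (λ e → -1ℤ ℤ.^ e ≡ -1ℤ mod + p) (≡.sym q≡p^[1+f]) (-1^q≡-1-mod-p pr f)

    Z^[q^t]≡Z : ∀ t → Z ^ᴹ (q ^ t) ≋ Z mod + p
    Z^[q^t]≡Z zero    = ≋⇒≋-mod (M.*-identityʳ Z)
    Z^[q^t]≡Z (suc t) = ≋ₘ.trans (≋⇒≋-mod (x^[m*n]≈[x^n]^m Z q (q ^ t)))
                                (≋ₘ.trans (^ᴹ-cong-mod (Z^[q^t]≡Z t) q) Z^q≡Z)

    module Precision (N : ℕ) where

      P : ℤ
      P = + (p ^ suc N)

      lift-q : ∀ {A B} → Commute A B → A ≋ B mod + p → A ^ᴹ (q ^ N) ≋ B ^ᴹ (q ^ N) mod P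
      lift-q {A} {B} AB A≡B = ≡.subst (λ e → A ^ᴹ e ≋ B ^ᴹ e mod P) (≡.sym q^N≡p^[[1+f]*N])
        (≋-mod-weaken (ℤ∣.∣ᵤ⇒∣ (^-monoʳ-∣ p (ℕ.s≤s (ℕP.m≤n*m N (suc f))))) (lift p AB A≡B (suc f ℕ.* N)))
        where
        q^N≡p^[[1+f]*N] : q ^ N ≡ p ^ (suc f ℕ.* N)
        q^N≡p^[[1+f]*N] = ≡.trans (≡.cong (_^ N) q≡p^[1+f]) (ℕP.^-*-assoc p (suc f) N)

      Y : Matrix q
      Y = Z ^ᴹ (q ^ N)

      Y∈C″ : Bicommutant C Y
      Y∈C″ = bicommutant-^ Z∈C″ (q ^ N)

      Y≡Z : Y ≋ Z mod + p
      Y≡Z = Z^[q^t]≡Z N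

      Y^q≡Y : Y ^ᴹ q ≋ Y mod P
      Y^q≡Y = begin
        (Z ^ᴹ (q ^ N)) ^ᴹ q    ≈⟨ ≋⇒≋-mod (x^[m*n]≈[x^n]^m Z q (q ^ N)) ⟨
        Z ^ᴹ (q ℕ.* q ^ N)     ≈⟨ ≋⇒≋-mod (^-congʳ Z (ℕP.*-comm q (q ^ N))) ⟩
        Z ^ᴹ (q ^ N ℕ.* q)     ≈⟨ ≋⇒≋-mod (x^[m*n]≈[x^n]^m Z (q ^ N) q) ⟩
        (Z ^ᴹ q) ^ᴹ (q ^ N)    ≈⟨ lift-q (bicommutant-commute (bicommutant-^ Z∈C″ q) Z∈C″) Z^q≡Z ⟩
        Z ^ᴹ (q ^ N)           ∎
        where open import Relation.Binary.Reasoning.Setoid (≋-mod-setoid P)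

      Y^[1+x%d]≡Y^[1+x] : ∀ x → x ℕ.≤ d → Y ^ᴹ suc (x DM.% d) ≋ Y ^ᴹ suc x mod P
      Y^[1+x%d]≡Y^[1+x] x x≤d with ℕP.m≤n⇒m<n∨m≡n x≤d
      ... | inj₁ x<d    = ≋⇒≋-mod (^-congʳ Y (≡.cong suc (DM.m<n⇒m%n≡m x<d)))
      ... | inj₂ ≡.refl = ≋ₘ.trans (≋⇒≋-mod (M.trans (^-congʳ Y (≡.cong suc (DM.n%n≡0 d))) (M.*-identityʳ Y)))
                                   (≋ₘ.sym Y^q≡Y)

      -- U e_b = Y^b e₀. Both C and Y act on these columns as b ↦ b + 1, except at b = d, where
      -- ρ d = 1 is matched by Y^q ≡ Y.
      U : Matrix q
      U a b = (Y ^ᴹ toℕ b) a zero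

      opaque
        unfolding _*ᴹ_ 1ᴹ

        *ᴹ-U : ∀ A a b → (A *ᴹ U) a b ≡ (A *ᴹ Y ^ᴹ toℕ b) a zero
        *ᴹ-U A a b = ≡.refl

        *ᴹ-U-column₀ : ∀ A a → (A *ᴹ U) a zero ≡ A a zero
        *ᴹ-U-column₀ A a = ∑-f*δ zero (A a)

      Intertwines : Matrix q → Matrix q → Set
      Intertwines A B = U *ᴹ A ≋ B *ᴹ U mod P

      intertwines-C-Y : Intertwines C Y
      intertwines-C-Y a b = begin
        (U *ᴹ C) a b                              ≡⟨ *ᴹ-⟦⟧ U (ρ^ 1) a b ⟩
        (Y ^ᴹ suc (toℕ (toℕ b DM.mod d))) a zero  ≡⟨ ≡.cong (λ e → (Y ^ᴹ suc e) a zero) (toℕ-mod (toℕ b)) ⟩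
        (Y ^ᴹ suc (toℕ b DM.% d)) a zero          ≈⟨ Y^[1+x%d]≡Y^[1+x] (toℕ b) (ℕP.≤-pred (FinP.toℕ<n b)) a zero ⟩
        (Y ^ᴹ suc (toℕ b)) a zero                 ≡⟨ *ᴹ-U Y a b ⟨
        (Y *ᴹ U) a b                              ∎
        where open import Relation.Binary.Reasoning.Setoid (≡-mod-setoid P)

      intertwines-* : ∀ {A A′ B B′} → Intertwines A B → Intertwines A′ B′ → Intertwines (A *ᴹ A′) (B *ᴹ B′)
      intertwines-* {A} {A′} {B} {B′} UA≡BU UA′≡B′U = begin
        U *ᴹ (A *ᴹ A′)    ≈⟨ ≋⇒≋-mod (M.*-assoc U A A′) ⟨
        U *ᴹ A *ᴹ A′      ≈⟨ *ᴹ-cong-mod UA≡BU ≋ₘ.refl ⟩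
        B *ᴹ U *ᴹ A′      ≈⟨ ≋⇒≋-mod (M.*-assoc B U A′) ⟩
        B *ᴹ (U *ᴹ A′)    ≈⟨ *ᴹ-cong-mod ≋ₘ.refl UA′≡B′U ⟩
        B *ᴹ (B′ *ᴹ U)    ≈⟨ ≋⇒≋-mod (M.*-assoc B B′ U) ⟨
        B *ᴹ B′ *ᴹ U      ∎
        where open import Relation.Binary.Reasoning.Setoid (≋-mod-setoid P)

      intertwines-+ : ∀ {A A′ B B′} → Intertwines A B → Intertwines A′ B′ → Intertwines (A +ᴹ A′) (B +ᴹ B′)
      intertwines-+ {A} {A′} {B} {B′} UA≡BU UA′≡B′U =
        ≋ₘ.trans (≋⇒≋-mod (M.distribˡ U A A′))
          (≋ₘ.trans (+ᴹ-cong-mod UA≡BU UA′≡B′U) (≋⇒≋-mod (M.sym (M.distribʳ U B B′))))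

      intertwines-1 : Intertwines 1ᴹ 1ᴹ
      intertwines-1 = ≋⇒≋-mod (M.trans (M.*-identityʳ U) (M.sym (M.*-identityˡ U)))

      intertwines-- : ∀ {A B} → Intertwines A B → Intertwines (-ᴹ A) (-ᴹ B)
      intertwines-- {A} {B} UA≡BU =
        ≋ₘ.trans (≋⇒≋-mod (M.sym (-‿distribʳ-* U A)))
          (≋ₘ.trans (-ᴹ-cong-mod UA≡BU) (≋⇒≋-mod (-‿distribˡ-* B U)))
        where open import Algebra.Properties.Ring (matrixRing q) using (-‿distribˡ-*; -‿distribʳ-*)

      intertwines-^ : ∀ {A B} → Intertwines A B → ∀ k → Intertwines (A ^ᴹ k) (B ^ᴹ k)
      intertwines-^ UA≡BU zero    = intertwines-1
      intertwines-^ UA≡BU (suc k) = intertwines-* UA≡BU (intertwines-^ UA≡BU k)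

      intertwines-resp : ∀ {A B B′} → Intertwines A B → B ≋ B′ mod P → Intertwines A B′
      intertwines-resp UA≡BU B≡B′ = ≋ₘ.trans UA≡BU (*ᴹ-cong-mod B≡B′ ≋ₘ.refl)

      intertwines-Y-C : Intertwines Y C
      intertwines-Y-C = intertwines-resp (intertwines-^ intertwines-Z-Z′ (q ^ N))
                          (≋ₘ.trans (lift-q Z′C Z′≡C) (≋⇒≋-mod (C^[q^t]≋C N)))
        where
        Z′ : Matrix q
        Z′ = -ᴹ (Y +ᴹ 1ᴹ)
        intertwines-Z-Z′ : Intertwines Z Z′
        intertwines-Z-Z′ = intertwines-- (intertwines-+ intertwines-C-Y intertwines-1)
        Z′C : Commute Z′ C
        Z′C = bicommutant-commute (bicommutant-- (bicommutant-+ Y∈C″ (bicommutant-1# C))) (bicommutant-self C)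
        Z′≡C : Z′ ≋ C mod + p
        Z′≡C = ≋ₘ.trans (-ᴹ-cong-mod (+ᴹ-cong-mod Y≡Z ≋ₘ.refl))
                 (≋⇒≋-mod (M.trans (M.-‿cong (-[x+1]+1≈-x C)) (-‿involutive C)))

      U*U≡1 : U *ᴹ U ≋ 1ᴹ mod P
      U*U≡1 a b = begin
        (U *ᴹ U) a b                    ≡⟨ *ᴹ-U U a b ⟩
        (U *ᴹ Y ^ᴹ toℕ b) a zero        ≈⟨ intertwines-^ intertwines-Y-C (toℕ b) a zero ⟩
        (C ^ᴹ toℕ b *ᴹ U) a zero        ≡⟨ *ᴹ-U-column₀ (C ^ᴹ toℕ b) a ⟩
        (C ^ᴹ toℕ b) a zero             ≡⟨ C^-column₀ b a ⟩
        δ a b                           ≡⟨ 1ᴹ≋⟦id⟧ a b ⟨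
        1ᴹ a b                          ∎
        where open import Relation.Binary.Reasoning.Setoid (≡-mod-setoid P)

      trace-intertwines : ∀ {A B} → Intertwines A B → trace A ≡ trace B mod P
      trace-intertwines {A} {B} UA≡BU = begin
        trace A                  ≡⟨ trace-cong (M.*-identityˡ A) ⟨
        trace (1ᴹ *ᴹ A)          ≈⟨ trace-cong-mod (*ᴹ-cong-mod (≋ₘ.sym U*U≡1) ≋ₘ.refl) ⟩
        trace (U *ᴹ U *ᴹ A)      ≡⟨ trace-cong (M.*-assoc U U A) ⟩
        trace (U *ᴹ (U *ᴹ A))    ≡⟨ trace-*ᴹ-comm U (U *ᴹ A) ⟩
        trace (U *ᴹ A *ᴹ U)      ≈⟨ trace-cong-mod (*ᴹ-cong-mod UA≡BU ≋ₘ.refl) ⟩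
        trace (B *ᴹ U *ᴹ U)      ≡⟨ trace-cong (M.*-assoc B U U) ⟩
        trace (B *ᴹ (U *ᴹ U))    ≈⟨ trace-cong-mod (*ᴹ-cong-mod ≋ₘ.refl U*U≡1) ⟩
        trace (B *ᴹ 1ᴹ)          ≡⟨ trace-cong (M.*-identityʳ B) ⟩
        trace B                  ∎
        where open import Relation.Binary.Reasoning.Setoid (≡-mod-setoid P)

      trace-transfer : ∀ a s → trace (mixedPower C a s ^ᴹ (p ^ N)) ≡ trace (mixedPower Z a s ^ᴹ (p ^ N)) mod P
      trace-transfer a s = begin
        trace (mixedPower C a s ^ᴹ (p ^ N))  ≈⟨ trace-intertwines (intertwines-^ intertwines-mixedPower (p ^ N)) ⟩
        trace (mixedPower Y a s ^ᴹ (p ^ N))  ≈⟨ trace-cong-mod (lift p YZ-commute mixedPower-Y≡Z N) ⟩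
        trace (mixedPower Z a s ^ᴹ (p ^ N))  ∎
        where
        open import Relation.Binary.Reasoning.Setoid (≡-mod-setoid P)
        intertwines-mixedPower : Intertwines (mixedPower C a s) (mixedPower Y a s)
        intertwines-mixedPower = intertwines-* (intertwines-^ intertwines-C-Y a)
                                               (intertwines-^ (intertwines-+ intertwines-C-Y intertwines-1) s)
        YZ-commute : Commute (mixedPower Y a s) (mixedPower Z a s)
        YZ-commute = bicommutant-commute (mixedPower∈C″ Y∈C″ a s) (mixedPower∈C″ Z∈C″ a s)
        mixedPower-Y≡Z : mixedPower Y a s ≋ mixedPower Z a s mod + p
        mixedPower-Y≡Z = *ᴹ-cong-mod (^ᴹ-cong-mod Y≡Z a) (^ᴹ-cong-mod (+ᴹ-cong-mod Y≡Z ≋ₘ.refl) s)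

  module BinomialSumCongruence {p : ℕ} (pr : Prime p) (f d : ℕ) .{{_ : NonZero d}} (q≡p^[1+f] : suc d ≡ p ^ suc f)
      (h k t r s : ℕ) .{{_ : NonZero r}} .{{_ : NonZero s}} (k≤h : k ℕ.≤ h) (h+k≡[1+f]*t : h ℕ.+ k ≡ suc f ℕ.* t) where

    open TeichmüllerLift pr f d q≡p^[1+f]
    open Precision k
    open CommutingElements (matrixRing q)
    private
      module M = Ring (matrixRing q)
    open import Algebra.Properties.Semiring.Exp M.semiring using (^-congˡ; ^-congʳ; ^-assocʳ)

    pk a : ℕ
    pk = p ^ k
    a = r ℕ.* p ^ h

    instance
      p≢0 : NonZero p
      p≢0 = prime⇒nonZero pr
      pk≢0 : NonZero pk
      pk≢0 = ℕP.m^n≢0 p k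
      s*pk≢0 : NonZero (s ℕ.* pk)
      s*pk≢0 = ℕP.m*n≢0 s pk

    ε : ℤ
    ε = -1ℤ ℤ.^ ((a ℕ.+ s) ℕ.* pk)

    p⊥d : Coprime p d
    p⊥d {i} (i∣p , i∣d) = ℕ∣.∣1⇒≡1 (ℕ∣.∣m+n∣m⇒∣n (≡.subst (i ℕ∣.∣_) (ℕP.+-comm 1 d) i∣1+d) i∣d)
      where
      i∣1+d : i ℕ∣.∣ suc d
      i∣1+d = ≡.subst (i ℕ∣.∣_) (≡.sym q≡p^[1+f]) (ℕ∣.∣-trans i∣p (ℕ∣.m∣m*n (p ^ f)))

    C+1∈C″ : Bicommutant C (C +ᴹ 1ᴹ)
    C+1∈C″ = bicommutant-+ (bicommutant-self C) (bicommutant-1# C)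

    C^[a*pk]≋C^r : C ^ᴹ (a ℕ.* pk) ≋ C ^ᴹ r
    C^[a*pk]≋C^r = M.trans (^-congʳ C a*pk≡r*q^t) (M.trans (x^[m*n]≈[x^n]^m C r (q ^ t)) (^-congˡ r (C^[q^t]≋C t)))
      where
      a*pk≡r*q^t : a ℕ.* pk ≡ r ℕ.* q ^ t
      a*pk≡r*q^t = begin
        r ℕ.* p ^ h ℕ.* p ^ k      ≡⟨ ℕP.*-assoc r (p ^ h) (p ^ k) ⟩
        r ℕ.* (p ^ h ℕ.* p ^ k)    ≡⟨ ≡.cong (r ℕ.*_) (ℕP.^-distribˡ-+-* p h k) ⟨
        r ℕ.* p ^ (h ℕ.+ k)        ≡⟨ ≡.cong (λ e → r ℕ.* p ^ e) h+k≡[1+f]*t ⟩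
        r ℕ.* p ^ (suc f ℕ.* t)    ≡⟨ ≡.cong (r ℕ.*_) (ℕP.^-*-assoc p (suc f) t) ⟨
        r ℕ.* (p ^ suc f) ^ t      ≡⟨ ≡.cong (λ x → r ℕ.* x ^ t) q≡p^[1+f] ⟨
        r ℕ.* q ^ t                ∎
        where open ≡.≡-Reasoning

    d*binomSum≡trace-mixedPower-C : + d * binomSum (s ℕ.* pk) d r ≡ trace (mixedPower C a s ^ᴹ pk)
    d*binomSum≡trace-mixedPower-C = begin
      + d * binomSum n d r
        ≡⟨ ≡.cong (+ d *_) (≡.trans (binomSum≡∑𝟙 n d r)
                                    (≡.sym (∑-sumUpTo (suc n) (λ j → + (n choose j) * 𝟙[ d ∣ r ℕ.+ j ])))) ⟩
      + d * ∑[ j < suc n ] (+ (n choose toℕ j) * 𝟙[ d ∣ r ℕ.+ toℕ j ])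
        ≡⟨ ≡.cong (+ d *_) (sum-cong-≗ {suc n} (λ j → ≡.cong (λ e → + (n choose toℕ j) * 𝟙[ d ∣ r ℕ.+ e ])
                                                               (≡.sym (ℕP.*-identityˡ (toℕ j))))) ⟩
      + d * ∑[ j < suc n ] (+ (n choose toℕ j) * 𝟙[ d ∣ r ℕ.+ 1 ℕ.* toℕ j ])
        ≡⟨ trace-binomial r 1 n ⟨
      trace (C ^ᴹ r *ᴹ (C ^ᴹ 1 +ᴹ 1ᴹ) ^ᴹ n)
        ≡⟨ trace-cong powers ⟨
      trace (mixedPower C a s ^ᴹ pk)
        ∎
      where
      open ≡.≡-Reasoning
      n = s ℕ.* pk
      powers : mixedPower C a s ^ᴹ pk ≋ C ^ᴹ r *ᴹ (C ^ᴹ 1 +ᴹ 1ᴹ) ^ᴹ n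
      powers = M.trans (*-^-distrib (bicommutant-commute (bicommutant-^ (bicommutant-self C) a) (bicommutant-^ C+1∈C″ s)) pk)
                 (M.*-cong (M.trans (^-assocʳ C a pk) C^[a*pk]≋C^r)
                           (M.trans (^-assocʳ (C +ᴹ 1ᴹ) s pk) (^-congˡ n (M.+-congʳ (M.sym (M.*-identityʳ C))))))

    trace-mixedPower-Z : trace (mixedPower Z a s ^ᴹ pk) ≡ ε * trace ((C +ᴹ 1ᴹ) ^ᴹ (a ℕ.* pk) *ᴹ C ^ᴹ (s ℕ.* pk))
    trace-mixedPower-Z = ≡.trans (trace-cong signs) (trace-∙ ε _)
      where
      W : Matrix q
      W = (C +ᴹ 1ᴹ) ^ᴹ a *ᴹ C ^ᴹ s
      Z^a≋ : Z ^ᴹ a ≋ (-1ℤ ℤ.^ a) ∙ (C +ᴹ 1ᴹ) ^ᴹ a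
      Z^a≋ = M.trans (^-congˡ a (-ᴹ≋-1∙ (C +ᴹ 1ᴹ))) (∙-^ᴹ -1ℤ (C +ᴹ 1ᴹ) a)
      [Z+1]^s≋ : (Z +ᴹ 1ᴹ) ^ᴹ s ≋ (-1ℤ ℤ.^ s) ∙ C ^ᴹ s
      [Z+1]^s≋ = M.trans (^-congˡ s (M.trans (-[x+1]+1≈-x C) (-ᴹ≋-1∙ C))) (∙-^ᴹ -1ℤ C s)
      mixedPower-Z≋ : mixedPower Z a s ≋ (-1ℤ ℤ.^ (a ℕ.+ s)) ∙ W
      mixedPower-Z≋ = M.trans (M.*-cong Z^a≋ [Z+1]^s≋)
        (M.trans (∙-*ᴹ-∙ (-1ℤ ℤ.^ a) (-1ℤ ℤ.^ s) _ _) (M.reflexive (≡.cong (_∙ W) (≡.sym (ℤP.^-distribˡ-+-* -1ℤ a s)))))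
      signs : mixedPower Z a s ^ᴹ pk ≋ ε ∙ ((C +ᴹ 1ᴹ) ^ᴹ (a ℕ.* pk) *ᴹ C ^ᴹ (s ℕ.* pk))
      signs = M.trans (^-congˡ pk mixedPower-Z≋) (M.trans (∙-^ᴹ (-1ℤ ℤ.^ (a ℕ.+ s)) W pk)
        (M.trans (M.reflexive (≡.cong (_∙ (W ^ᴹ pk)) (ℤP.^-*-assoc -1ℤ (a ℕ.+ s) pk)))
          (∙-congˡ ε (M.trans (*-^-distrib (bicommutant-commute (bicommutant-^ C+1∈C″ a) (bicommutant-^ (bicommutant-self C) s)) pk)
                              (M.*-cong (^-assocʳ (C +ᴹ 1ᴹ) a pk) (^-assocʳ C s pk))))))

    frobenius-lifted : (C +ᴹ 1ᴹ) ^ᴹ (a ℕ.* pk) ≋ (C ^ᴹ pk +ᴹ 1ᴹ) ^ᴹ a mod + (p ^ suc h)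
    frobenius-lifted = begin
      (C +ᴹ 1ᴹ) ^ᴹ (a ℕ.* pk)              ≈⟨ ≋⇒≋-mod (x^[m*n]≈[x^n]^m (C +ᴹ 1ᴹ) a pk) ⟩
      ((C +ᴹ 1ᴹ) ^ᴹ pk) ^ᴹ (r ℕ.* p ^ h)    ≈⟨ ≋⇒≋-mod (x^[m*n]≈[x^n]^m ((C +ᴹ 1ᴹ) ^ᴹ pk) r (p ^ h)) ⟩
      (((C +ᴹ 1ᴹ) ^ᴹ pk) ^ᴹ (p ^ h)) ^ᴹ r  ≈⟨ ^ᴹ-cong-mod (lift p commutes (frobenius-^ pr C k) h) r ⟩
      ((C ^ᴹ pk +ᴹ 1ᴹ) ^ᴹ (p ^ h)) ^ᴹ r    ≈⟨ ≋⇒≋-mod (M.sym (x^[m*n]≈[x^n]^m (C ^ᴹ pk +ᴹ 1ᴹ) r (p ^ h))) ⟩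
      (C ^ᴹ pk +ᴹ 1ᴹ) ^ᴹ a                 ∎
      where
      open import Relation.Binary.Reasoning.Setoid (≋-mod-setoid (+ (p ^ suc h)))
      commutes : Commute ((C +ᴹ 1ᴹ) ^ᴹ pk) (C ^ᴹ pk +ᴹ 1ᴹ)
      commutes = bicommutant-commute (bicommutant-^ C+1∈C″ pk)
                   (bicommutant-+ (bicommutant-^ (bicommutant-self C) pk) (bicommutant-1# C))

    trace≡d*binomSum : trace ((C +ᴹ 1ᴹ) ^ᴹ (a ℕ.* pk) *ᴹ C ^ᴹ (s ℕ.* pk)) ≡ + d * binomSum a d s mod P
    trace≡d*binomSum = begin
      trace ((C +ᴹ 1ᴹ) ^ᴹ (a ℕ.* pk) *ᴹ C ^ᴹ (s ℕ.* pk))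
        ≈⟨ trace-cong-mod (*ᴹ-cong-mod (≋-mod-weaken (ℤ∣.∣ᵤ⇒∣ (^-monoʳ-∣ p (ℕ.s≤s k≤h))) frobenius-lifted)
                                       ≋ₘ.refl) ⟩
      trace ((C ^ᴹ pk +ᴹ 1ᴹ) ^ᴹ a *ᴹ C ^ᴹ (s ℕ.* pk))
        ≡⟨ trace-*ᴹ-comm ((C ^ᴹ pk +ᴹ 1ᴹ) ^ᴹ a) (C ^ᴹ (s ℕ.* pk)) ⟩
      trace (C ^ᴹ (s ℕ.* pk) *ᴹ (C ^ᴹ pk +ᴹ 1ᴹ) ^ᴹ a)
        ≡⟨ trace-binomial (s ℕ.* pk) pk a ⟩
      + d * ∑[ j < suc a ] (+ (a choose toℕ j) * 𝟙[ d ∣ s ℕ.* pk ℕ.+ pk ℕ.* toℕ j ])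
        ≡⟨ ≡.cong (+ d *_) (sum-cong-≗ {suc a} (λ j → ≡.cong (+ (a choose toℕ j) *_) (drop-pk (toℕ j)))) ⟩
      + d * ∑[ j < suc a ] (+ (a choose toℕ j) * 𝟙[ d ∣ s ℕ.+ toℕ j ])
        ≡⟨ ≡.cong (+ d *_) (≡.trans (∑-sumUpTo (suc a) (λ j → + (a choose j) * 𝟙[ d ∣ s ℕ.+ j ]))
                                    (≡.sym (binomSum≡∑𝟙 a d s))) ⟩
      + d * binomSum a d s
        ∎
      where
      open import Relation.Binary.Reasoning.Setoid (≡-mod-setoid P)
      drop-pk : ∀ j → 𝟙[ d ∣ s ℕ.* pk ℕ.+ pk ℕ.* j ] ≡ 𝟙[ d ∣ s ℕ.+ j ]
      drop-pk j = ≡.trans (≡.cong 𝟙[ d ∣_] (≡.trans (≡.cong (ℕ._+ pk ℕ.* j) (ℕP.*-comm s pk))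
                                                  (≡.sym (ℕP.*-distribˡ-+ pk s j))))
                          (𝟙-coprime-* (Coprimality.sym (coprime-^ p⊥d k)) (s ℕ.+ j))

    d*binomSum-congruence : + d * binomSum (s ℕ.* pk) d r ≡ ε * (+ d * binomSum a d s) mod P
    d*binomSum-congruence = begin
      + d * binomSum (s ℕ.* pk) d r                                  ≡⟨ d*binomSum≡trace-mixedPower-C ⟩
      trace (mixedPower C a s ^ᴹ pk)                                 ≈⟨ trace-transfer a s ⟩
      trace (mixedPower Z a s ^ᴹ pk)                                 ≡⟨ trace-mixedPower-Z ⟩
      ε * trace ((C +ᴹ 1ᴹ) ^ᴹ (a ℕ.* pk) *ᴹ C ^ᴹ (s ℕ.* pk))          ≈⟨ *-congˡ-mod ε trace≡d*binomSum ⟩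
      ε * (+ d * binomSum a d s)                                     ∎
      where open import Relation.Binary.Reasoning.Setoid (≡-mod-setoid P)

    binomial-sums-congruence :
      -1ℤ ℤ.^ (p ℕ.* s) * binomSum (s ℕ.* pk) d r ≡ -1ℤ ℤ.^ (p ℕ.* r) * binomSum a d s mod P
    binomial-sums-congruence = begin
      -1ℤ ℤ.^ (p ℕ.* s) * B₁                ≈⟨ *-congˡ-mod (-1ℤ ℤ.^ (p ℕ.* s)) B₁≡εB₂ ⟩
      -1ℤ ℤ.^ (p ℕ.* s) * (ε * B₂)          ≡⟨ ℤP.*-assoc (-1ℤ ℤ.^ (p ℕ.* s)) ε B₂ ⟨
      -1ℤ ℤ.^ (p ℕ.* s) * ε * B₂            ≈⟨ *-congʳ-mod B₂ (sign-congruence pr h k r s) ⟩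
      -1ℤ ℤ.^ (p ℕ.* r) * B₂                ∎
      where
      open import Relation.Binary.Reasoning.Setoid (≡-mod-setoid P)
      B₁ = binomSum (s ℕ.* pk) d r
      B₂ = binomSum a d s
      B₁≡εB₂ : B₁ ≡ ε * B₂ mod P
      B₁≡εB₂ = *-cancelˡ-coprime-mod (coprime-^ p⊥d (suc k))
        (≡ₘ.trans d*binomSum-congruence (≡⇒≡-mod (ℤ*.x∙yz≈y∙xz ε (+ d) B₂)))

open import Data.Nat using (ℕ; suc; _*_; _+_; _∸_; _^_; _<_; _≤_)
open import Data.Nat.Divisibility using (_∣_; divides)
open import Data.Nat.Primality using (Prime; prime⇒nonZero)
open import Data.Integer using (ℤ; +_; -1ℤ) renaming (_*_ to _*ℤ_; _-_ to _-ℤ_; _^_ to _^ℤ_)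
open import Data.Integer.Divisibility using () renaming (_∣_ to _∣ℤ_)
import Data.Integer.Divisibility.Signed as ℤ∣
open import Relation.Binary.PropositionalEquality using (_≡_; trans)

theorem1p2 : (p f h k r s : ℕ) → Prime p → 0 < f → k ≤ h → f ∣ (h + k) → 0 < r → 0 < s →
  (+ (p ^ suc k)) ∣ℤ
    ((-1ℤ ^ℤ (p * s)) *ℤ binomSum (s * p ^ k) (p ^ f ∸ 1) r
      -ℤ (-1ℤ ^ℤ (p * r)) *ℤ binomSum (r * p ^ h) (p ^ f ∸ 1) s)
theorem1p2 p (suc f) h k r@(suc _) s@(suc _) pr _ k≤h (divides t h+k≡t*[1+f]) _ _ =
  ℤ∣.∣⇒∣ᵤ (divides-difference (BinomialSumCongruence.binomial-sums-congruence pr f (p ^ suc f ∸ 1) q≡p^[1+f]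
    h k t r s k≤h (trans h+k≡t*[1+f] (ℕP.*-comm t (suc f)))))
  where
  instance
    d≢0 : ℕ.NonZero (p ^ suc f ∸ 1)
    d≢0 = pred[p^[1+f]]≢0 pr f
  q≡p^[1+f] : suc (p ^ suc f ∸ 1) ≡ p ^ suc f
  q≡p^[1+f] = ℕP.suc-pred (p ^ suc f) {{ℕP.m^n≢0 p (suc f) {{prime⇒nonZero pr}}}}
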